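{- Let $U=(u_1,\dots,u_d)$ and $V=(v_1,\dots,v_d)$ be non-increasing sequences of positive integers and $UV=(u_1v_1,\dots,u_dv_d)$. Then $\{T_U\}\otimes\{T_V\}\cong\{T_{UV}\}$.
   Context: Graphs are directed. $\bullet$ is the one-vertex rooted tree; $k\times G$ is $k$ disjoint copies of $G$, $\oplus$ is disjoint union. For a forest $G=T_1\oplus\cdots\oplus T_k$ of rooted trees, $\langle G\rangle$ is the rooted tree whose root has exactly $k$ predecessors, the $i$-th being the root of a copy of $T_i$. For a rooted tree $T$, $\{T\}$ is $T$ with a loop added at the root. For a non-increasing sequence $W=(w_1,\dots,w_d)$ of positive integers, $T^0_W=\bullet$, $T^k_W=\langle w_k\times T^{k-1}_W\oplus\bigoplus_{i=1}^{k-1}(w_i-w_{i+1})\times T^{i-1}_W\rangle$ for $1\le k<d$, and $T_W=\langle(w_d-1)\times T^{d-1}_W\oplus\bigoplus_{i=1}^{d-1}(w_i-w_{i+1})\times T^{i-1}_W\rangle$. The tensor product $G_1\otimes G_2$ has vertex set $V_{G_1}\times V_{G_2}$ and an edge $(v_1,v_2)\to(w_1,w_2)$ iff $v_i\to w_i$ is an edge in $G_i$ for $i=1,2$. -}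

module Defs where

open import Data.Nat using (ℕ; zero; suc; _∸_; _*_; _≤_; _<_)
open import Data.Fin using (Fin)
open import Data.Vec using (Vec; []; _∷_; lookup; zipWith)
open import Data.List using (List; []; _∷_; _++_; replicate)
open import Data.List.Membership.Propositional using (_∈_)
open import Data.Product using (_×_; _,_)
open import Data.Sum using (_⊎_)
open import Relation.Binary.PropositionalEquality using (_≡_)
open import Function.Bundles using (_↔_; Inverse)
open import Level using (0ℓ)

record Graph : Set₁ where
  field
    V : Set
    E : V → V → Set
open Graph public

record _≅_ (G H : Graph) : Set where
  field
    bij  : V G ↔ V H
    edge : ∀ x y → (E G x y → E H (Inverse.to bij x) (Inverse.to bij y))
                 × (E H (Inverse.to bij x) (Inverse.to bij y) → E G x y)

_⊗_ : Graph → Graph → Graph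
G ⊗ H = record { V = V G × V H
               ; E = λ { (a , b) (c , d) → E G a c × E H b d } }

-- Rooted trees: a rooted tree is ⟨ forest ⟩, the forest being the list
-- of subtrees whose roots are the predecessors of the root.

data Tree : Set where
  ⟨_⟩ : List Tree → Tree

• : Tree
• = ⟨ [] ⟩

-- vertices of a tree: the root, or a vertex inside a chosen subtree
-- (the membership proof identifies which copy, so duplicates are distinct)
data Pos : Tree → Set where
  root : ∀ {ts} → Pos ⟨ ts ⟩
  sub  : ∀ {ts t} → t ∈ ts → Pos t → Pos ⟨ ts ⟩

rootOf : (t : Tree) → Pos t
rootOf ⟨ ts ⟩ = root

-- edges point from a vertex to its parent (predecessor → successor)
data Edge : {t : Tree} → Pos t → Pos t → Set where
  toRoot : ∀ {ts t} (m : t ∈ ts) → Edge (sub m (rootOf t)) (root {ts})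
  inside : ∀ {ts t} (m : t ∈ ts) {p q : Pos t} → Edge p q → Edge (sub m p) (sub m q)

-- {T}: T with a loop added at the root
Looped : Tree → Graph
Looped t = record { V = Pos t
                  ; E = λ p q → Edge p q ⊎ (p ≡ rootOf t × q ≡ rootOf t) }

-- The trees T^k_W and T_W.  w is the 1-indexed sequence w_1, w_2, ...

mutual
  tree : (ℕ → ℕ) → ℕ → Tree
  tree w zero    = •
  tree w (suc k) = ⟨ replicate (w (suc k)) (tree w k) ++ extra w k ⟩

  extra : (ℕ → ℕ) → ℕ → List Tree
  extra w zero    = []
  extra w (suc k) = extra w k ++ replicate (w (suc k) ∸ w (suc (suc k))) (tree w k)

-- 1-indexed access (0 outside range; only used within range)
at : ∀ {m} → Vec ℕ m → ℕ → ℕ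
at []       _             = 0
at (x ∷ xs) zero          = 0
at (x ∷ xs) (suc zero)    = x
at (x ∷ xs) (suc (suc i)) = at xs (suc i)

T : ∀ {n} → Vec ℕ (suc n) → Tree
T {n} w = ⟨ replicate (at w (suc n) ∸ 1) (tree (at w) n) ++ extra (at w) n ⟩

NonIncPos : ∀ {d} → Vec ℕ d → Set
NonIncPos {d} w = (∀ (i : Fin d) → 0 < lookup w i)
                × (∀ (i j : Fin d) → i Data.Fin.≤ j → lookup w j ≤ lookup w i)

_·_ : ∀ {d} → Vec ℕ d → Vec ℕ d → Vec ℕ d
u · v = zipWith _*_ u v

-- {S} ⊗ {T} is again a looped tree S ⊛ T: the vertex (p , q) has the single successor
-- (parent p , parent q), and iterating reaches (root , root).  Below the root, a vertex
-- lies in a product of two subtrees whose shape depends on which coordinate reaches the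
-- root first (x ⊠ y, s ⊠≤ y or x ⊠≥ t below).  A tree T^k_W is determined up to
-- isomorphism by the heights of its subtrees: for m < k it has w_{m+1} subtrees of height
-- ≥ m, and the root of T_W has w_{m+1} - 1 of them.  By induction on heights,
-- T^j_U ⊠ T^k_V ≅ T^{min j k}_{UV}, T_U ⊠≤ T^k_V ≅ T^k_{UV} and T^j_U ⊠≥ T_V ≅ T^j_{UV},
-- and counting subtrees of height ≥ m reduces everything to u_{m+1} v_{m+1} = w_{m+1}.

module Submission where

open import Defs
open import Data.Nat using (ℕ; zero; suc; _+_; _*_; _∸_; _⊓_; _≤_; _≰_; _<_; z≤n; s≤s; _≤?_; _<?_; _≟_)
open import Data.Nat.Properties
open import Data.Nat.Induction using (<-rec)
open import Data.Fin using (fromℕ<)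
open import Data.Fin.Properties using (toℕ-fromℕ<)
open import Data.Vec using (Vec; []; _∷_; lookup)
open import Data.List using (List; []; _∷_; _++_; [_]; map; replicate; cartesianProductWith)
open import Data.List.Properties using (map-++; map-replicate)
open import Data.List.Relation.Unary.Any using (here; there)
open import Data.List.Relation.Unary.Any.Properties using (++⁺ˡ; ++⁺ʳ)
open import Data.List.Membership.Propositional using (_∈_)
open import Data.List.Membership.Propositional.Properties using (∈-++⁻; ∈-∃++)
open import Data.List.Relation.Binary.Pointwise using (Pointwise; []; _∷_)
import Data.List.Relation.Binary.Pointwise as Pointwise
open import Data.List.Relation.Binary.Permutation.Propositional using (_↭_; ↭-refl; ↭-sym; ↭-trans; ↭-prep)
open import Data.List.Relation.Binary.Permutation.Propositional.Properties
  using (∈-resp-↭; ∈-resp-[σ⁻¹∘σ]; ∈-resp-[σ∘σ⁻¹]; shift; map⁺)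
open import Data.Product using (_×_; _,_; proj₁; proj₂; uncurry)
open import Data.Sum using (inj₁; inj₂)
open import Data.Empty using (⊥-elim)
open import Relation.Nullary using (Dec; yes; no)
open import Relation.Binary.Bundles using (Setoid)
import Relation.Binary.Reasoning.Setoid
open import Relation.Binary.Definitions using (tri<; tri≈; tri>)
open import Relation.Binary.PropositionalEquality hiding ([_])
open import Algebra.Properties.CommutativeSemigroup +-commutativeSemigroup using (x∙yz≈y∙xz)
open import Function.Base using (_∘_)
open import Function.Bundles using (_↔_; Inverse; mk↔ₛ′)
open import Function.Properties.Inverse using (↔-trans)

-- Looped trees as functional graphs

depth : ∀ {t} → Pos t → ℕ
depth root      = 0
depth (sub _ p) = suc (depth p)

parent : ∀ {t} → Pos t → Pos t
parent root               = root
parent (sub m root)       = root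
parent (sub m (sub m′ p)) = sub m (parent (sub m′ p))

LoopEdge : ∀ {t} → Pos t → Pos t → Set
LoopEdge {t} = E (Looped t)

edge⇒parent : ∀ {t} {p q : Pos t} → Edge p q → q ≡ parent p
edge⇒parent (toRoot {t = ⟨ _ ⟩} m)     = refl
edge⇒parent (inside m {p = sub _ _} e) = cong (sub m) (edge⇒parent e)

loopEdge⇒parent : ∀ {t} {p q : Pos t} → LoopEdge p q → q ≡ parent p
loopEdge⇒parent (inj₁ e)                     = edge⇒parent e
loopEdge⇒parent {⟨ _ ⟩} (inj₂ (refl , refl)) = refl

loopEdge-parent : ∀ {t} (p : Pos t) → LoopEdge p (parent p)
loopEdge-parent {⟨ _ ⟩} root           = inj₂ (refl , refl)
loopEdge-parent (sub {t = ⟨ _ ⟩} m root) = inj₁ (toRoot m)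
loopEdge-parent (sub m (sub m′ p)) with loopEdge-parent (sub m′ p)
... | inj₁ e = inj₁ (inside m e)

record Functional (G : Graph) : Set where
  field
    next      : V G → V G
    edge⇒next : ∀ x y → E G x y → y ≡ next x
    edge-next : ∀ x → E G x (next x)
open Functional

looped-functional : ∀ t → Functional (Looped t)
looped-functional t = record
  { next = parent ; edge⇒next = λ _ _ → loopEdge⇒parent ; edge-next = loopEdge-parent }

⊗-functional : ∀ {G H} → Functional G → Functional H → Functional (G ⊗ H)
⊗-functional FG FH = record
  { next      = λ (a , b) → next FG a , next FH b
  ; edge⇒next = λ (a , b) (c , d) (e₁ , e₂) → cong₂ _,_ (edge⇒next FG a c e₁) (edge⇒next FH b d e₂)
  ; edge-next = λ (a , b) → edge-next FG a , edge-next FH b }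

functional-≅ : ∀ {G H} (FG : Functional G) (FH : Functional H) (b : V G ↔ V H) →
               (∀ x → Inverse.to b (next FG x) ≡ next FH (Inverse.to b x)) → G ≅ H
functional-≅ {G} {H} FG FH b to-next = record { bij = b ; edge = λ x y → preserve x y , reflect x y }
  where
  open Inverse b
  preserve : ∀ x y → E G x y → E H (to x) (to y)
  preserve x y e = subst (E H (to x)) (sym (trans (cong to (edge⇒next FG x y e)) (to-next x)))
                         (edge-next FH (to x))
  reflect : ∀ x y → E H (to x) (to y) → E G x y
  reflect x y e = subst (E G x) (sym y≡next) (edge-next FG x)
    where
    y≡next : y ≡ next FG x
    y≡next = begin
      y                       ≡⟨ strictlyInverseʳ y ⟨
      from (to y)             ≡⟨ cong from (edge⇒next FH (to x) (to y) e) ⟩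
      from (next FH (to x))   ≡⟨ cong from (to-next x) ⟨
      from (to (next FG x))   ≡⟨ strictlyInverseʳ (next FG x) ⟩
      next FG x               ∎
      where open ≡-Reasoning

≅-trans : ∀ {G H K} → G ≅ H → H ≅ K → G ≅ K
≅-trans i j = record
  { bij  = ↔-trans (_≅_.bij i) (_≅_.bij j)
  ; edge = λ x y → (λ e → proj₁ (_≅_.edge j _ _) (proj₁ (_≅_.edge i x y) e))
                 , (λ e → proj₂ (_≅_.edge i x y) (proj₂ (_≅_.edge j _ _) e)) }

infix 4 _≃_

record _≃_ (s t : Tree) : Set where
  field
    to        : Pos s → Pos t
    from      : Pos t → Pos s
    to-from   : ∀ y → to (from y) ≡ y
    from-to   : ∀ x → from (to x) ≡ x
    to-parent : ∀ x → to (parent x) ≡ parent (to x)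
open _≃_

≃⇒≅ : ∀ {s t} → s ≃ t → Looped s ≅ Looped t
≃⇒≅ {s} {t} i = functional-≅ (looped-functional s) (looped-functional t)
                  (mk↔ₛ′ (to i) (from i) (to-from i) (from-to i)) (to-parent i)

≃-refl : ∀ {s} → s ≃ s
≃-refl = record
  { to = λ x → x ; from = λ x → x ; to-from = λ _ → refl ; from-to = λ _ → refl ; to-parent = λ _ → refl }

≃-sym : ∀ {s t} → s ≃ t → t ≃ s
≃-sym i = record
  { to = from i ; from = to i ; to-from = from-to i ; from-to = to-from i
  ; to-parent = λ y → begin
      from i (parent y)                    ≡⟨ cong (from i ∘ parent) (to-from i y) ⟨
      from i (parent (to i (from i y)))    ≡⟨ cong (from i) (to-parent i (from i y)) ⟨
      from i (to i (parent (from i y)))    ≡⟨ from-to i (parent (from i y)) ⟩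
      parent (from i y)                    ∎ }
  where open ≡-Reasoning

≃-trans : ∀ {r s t} → r ≃ s → s ≃ t → r ≃ t
≃-trans i j = record
  { to        = λ x → to j (to i x)
  ; from      = λ x → from i (from j x)
  ; to-from   = λ y → trans (cong (to j) (to-from i (from j y))) (to-from j y)
  ; from-to   = λ x → trans (cong (from i) (from-to j (to i x))) (from-to i x)
  ; to-parent = λ x → trans (cong (to j) (to-parent i x)) (to-parent j (to i x)) }

≃-setoid : Setoid _ _
≃-setoid = record
  { Carrier = Tree ; _≈_ = _≃_
  ; isEquivalence = record { refl = ≃-refl ; sym = ≃-sym ; trans = ≃-trans } }

module ≃-Reasoning = Relation.Binary.Reasoning.Setoid ≃-setoid

root? : ∀ {t} (p : Pos t) → Dec (p ≡ rootOf t)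
root? {⟨ _ ⟩} root = yes refl
root? (sub _ _)    = no λ ()

parent-fixed⇒root : ∀ {t} (p : Pos t) → parent p ≡ p → p ≡ rootOf t
parent-fixed⇒root {⟨ _ ⟩} root _ = refl
parent-fixed⇒root (sub m (sub m′ p)) eq with parent-fixed⇒root (sub m′ p) (sub-injective eq)
  where
  sub-injective : ∀ {ts t} {m : t ∈ ts} {a b : Pos t} → sub m a ≡ sub m b → a ≡ b
  sub-injective refl = refl
... | ()

to-root : ∀ {s t} (i : s ≃ t) → to i (rootOf s) ≡ rootOf t
to-root {⟨ _ ⟩} i = parent-fixed⇒root (to i root) (sym (to-parent i root))

to-nonroot : ∀ {s t} (i : s ≃ t) {p : Pos s} → p ≢ rootOf s → to i p ≢ rootOf t
to-nonroot i {p} p≢root eq = p≢root (begin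
  p                      ≡⟨ from-to i p ⟨
  from i (to i p)        ≡⟨ cong (from i) eq ⟩
  from i (rootOf _)      ≡⟨ to-root (≃-sym i) ⟩
  rootOf _               ∎)
  where open ≡-Reasoning

parent-sub : ∀ {ts t} (m : t ∈ ts) {p : Pos t} → p ≢ rootOf t → parent (sub m p) ≡ sub m (parent p)
parent-sub {t = ⟨ _ ⟩} m {root} p≢root = ⊥-elim (p≢root refl)
parent-sub m {sub _ _} _ = refl

parent-sub-root : ∀ {ts t} (m : t ∈ ts) → parent (sub m (rootOf t)) ≡ root
parent-sub-root {t = ⟨ _ ⟩} m = refl

there-pos : ∀ {t ts} → Pos ⟨ ts ⟩ → Pos ⟨ t ∷ ts ⟩
there-pos root      = root
there-pos (sub m q) = sub (there m) q

parent-there-pos : ∀ {t ts} (p : Pos ⟨ ts ⟩) → parent (there-pos {t} p) ≡ there-pos (parent p)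
parent-there-pos root               = refl
parent-there-pos (sub m root)       = refl
parent-there-pos (sub m (sub m′ p)) = refl

pointwise-to : ∀ {ss ts} → Pointwise _≃_ ss ts → Pos ⟨ ss ⟩ → Pos ⟨ ts ⟩
pointwise-to _        root                = root
pointwise-to (i ∷ _)  (sub (here refl) p) = sub (here refl) (to i p)
pointwise-to (_ ∷ is) (sub (there m) p)   = there-pos (pointwise-to is (sub m p))

pointwise-to-there-pos : ∀ {s t ss ts} (i : s ≃ t) (is : Pointwise _≃_ ss ts) (p : Pos ⟨ ss ⟩) →
                         pointwise-to (i ∷ is) (there-pos p) ≡ there-pos (pointwise-to is p)
pointwise-to-there-pos i is root      = refl
pointwise-to-there-pos i is (sub m q) = refl

pointwise-sym : ∀ {ss ts} → Pointwise _≃_ ss ts → Pointwise _≃_ ts ss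
pointwise-sym = Pointwise.symmetric ≃-sym

pointwise-from-to : ∀ {ss ts} (is : Pointwise _≃_ ss ts) (p : Pos ⟨ ss ⟩) →
                    pointwise-to (pointwise-sym is) (pointwise-to is p) ≡ p
pointwise-from-to is       root                = refl
pointwise-from-to (i ∷ is) (sub (here refl) p) = cong (sub (here refl)) (from-to i p)
pointwise-from-to (i ∷ is) (sub (there m) p)   =
  trans (pointwise-to-there-pos (≃-sym i) (pointwise-sym is) (pointwise-to is (sub m p)))
        (cong there-pos (pointwise-from-to is (sub m p)))

pointwise-to-parent : ∀ {ss ts} (is : Pointwise _≃_ ss ts) (p : Pos ⟨ ss ⟩) →
                      pointwise-to is (parent p) ≡ parent (pointwise-to is p)
pointwise-to-parent is       root = refl
pointwise-to-parent (i ∷ is) (sub (here refl) p) with root? p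
... | yes refl = trans (cong (pointwise-to (i ∷ is)) (parent-sub-root (here refl)))
                       (sym (trans (cong (parent ∘ sub (here refl)) (to-root i))
                                   (parent-sub-root (here refl))))
... | no p≢root = trans (cong (pointwise-to (i ∷ is)) (parent-sub (here refl) p≢root))
                        (trans (cong (sub (here refl)) (to-parent i p))
                               (sym (parent-sub (here refl) (to-nonroot i p≢root))))
pointwise-to-parent (i ∷ is) (sub (there m) root) =
  sym (trans (parent-there-pos (pointwise-to is (sub m root)))
             (cong there-pos (sym (pointwise-to-parent is (sub m root)))))
pointwise-to-parent (i ∷ is) (sub (there m) (sub m′ p)) =
  trans (cong there-pos (pointwise-to-parent is (sub m (sub m′ p))))
        (sym (parent-there-pos (pointwise-to is (sub m (sub m′ p)))))

-- ≃-sym is not definitionally involutive, but pointwise-to only looks at the to maps.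
pointwise-to-sym-sym : ∀ {ss ts} (is : Pointwise _≃_ ss ts) (p : Pos ⟨ ss ⟩) →
                       pointwise-to (pointwise-sym (pointwise-sym is)) p ≡ pointwise-to is p
pointwise-to-sym-sym is       root                = refl
pointwise-to-sym-sym (i ∷ is) (sub (here refl) p) = refl
pointwise-to-sym-sym (i ∷ is) (sub (there m) p)   = cong there-pos (pointwise-to-sym-sym is (sub m p))

pointwise⇒≃ : ∀ {ss ts} → Pointwise _≃_ ss ts → ⟨ ss ⟩ ≃ ⟨ ts ⟩
pointwise⇒≃ is = record
  { to        = pointwise-to is
  ; from      = pointwise-to (pointwise-sym is)
  ; to-from   = λ q → trans (sym (pointwise-to-sym-sym is (pointwise-to (pointwise-sym is) q)))
                            (pointwise-from-to (pointwise-sym is) q)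
  ; from-to   = pointwise-from-to is
  ; to-parent = pointwise-to-parent is }

↭⇒≃ : ∀ {ss ts} → ss ↭ ts → ⟨ ss ⟩ ≃ ⟨ ts ⟩
↭⇒≃ σ = record
  { to = permute σ ; from = permute (↭-sym σ)
  ; to-from = to-from′ ; from-to = from-to′ ; to-parent = to-parent′ }
  where
  permute : ∀ {as bs} → as ↭ bs → Pos ⟨ as ⟩ → Pos ⟨ bs ⟩
  permute σ root      = root
  permute σ (sub m p) = sub (∈-resp-↭ σ m) p
  to-from′ : ∀ q → permute σ (permute (↭-sym σ) q) ≡ q
  to-from′ root      = refl
  to-from′ (sub m q) = cong (λ m′ → sub m′ q) (∈-resp-[σ∘σ⁻¹] σ m)
  from-to′ : ∀ p → permute (↭-sym σ) (permute σ p) ≡ p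
  from-to′ root      = refl
  from-to′ (sub m p) = cong (λ m′ → sub m′ p) (∈-resp-[σ⁻¹∘σ] σ m)
  to-parent′ : ∀ p → permute σ (parent p) ≡ parent (permute σ p)
  to-parent′ root               = refl
  to-parent′ (sub m root)       = refl
  to-parent′ (sub m (sub m′ p)) = refl

-- Products of looped trees

children : Tree → List Tree
children ⟨ ts ⟩ = ts

-- The vertices of x ⊠ y are the pairs of vertices of equal depth, those of s ⊠≤ t the pairs
-- (p , q) with depth p ≤ depth q, those of s ⊠≥ t the pairs with depth q ≤ depth p, and
-- those of s ⊛ t all pairs; see the split and join maps below.

infixr 6 _⊠_ _⊠ʳ_ _⊠ᴸ_ _⊠≤_ _⊠≤ʳ_ _⊠≥_ _⊠≥ˡ_ _⊛_

mutual
  _⊠_ : Tree → Tree → Tree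
  ⟨ xs ⟩ ⊠ ⟨ ys ⟩ = ⟨ xs ⊠ᴸ ys ⟩

  _⊠ᴸ_ : List Tree → List Tree → List Tree
  []       ⊠ᴸ ys = []
  (x ∷ xs) ⊠ᴸ ys = x ⊠ʳ ys ++ xs ⊠ᴸ ys

  _⊠ʳ_ : Tree → List Tree → List Tree
  x ⊠ʳ []       = []
  x ⊠ʳ (y ∷ ys) = x ⊠ y ∷ x ⊠ʳ ys

mutual
  _⊠≤_ : Tree → Tree → Tree
  s ⊠≤ ⟨ ys ⟩ = ⟨ s ⊠≤ʳ ys ++ children s ⊠ᴸ ys ⟩

  _⊠≤ʳ_ : Tree → List Tree → List Tree
  s ⊠≤ʳ []       = []
  s ⊠≤ʳ (y ∷ ys) = s ⊠≤ y ∷ s ⊠≤ʳ ys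

mutual
  _⊠≥_ : Tree → Tree → Tree
  ⟨ xs ⟩ ⊠≥ t = ⟨ xs ⊠≥ˡ t ++ xs ⊠ᴸ children t ⟩

  _⊠≥ˡ_ : List Tree → Tree → List Tree
  []       ⊠≥ˡ t = []
  (x ∷ xs) ⊠≥ˡ t = x ⊠≥ t ∷ xs ⊠≥ˡ t

_⊛_ : Tree → Tree → Tree
s ⊛ t = ⟨ s ⊠≤ʳ children t ++ children s ⊠≥ˡ t ++ children s ⊠ᴸ children t ⟩

data ++-View {A : Set} {x : A} (xs ys : List A) : x ∈ xs ++ ys → Set where
  inˡ : (m : x ∈ xs) → ++-View xs ys (++⁺ˡ m)
  inʳ : (m : x ∈ ys) → ++-View xs ys (++⁺ʳ xs m)

++-view : ∀ {A : Set} {x : A} (xs : List A) {ys : List A} (m : x ∈ xs ++ ys) → ++-View xs ys m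
++-view [] m = inʳ m
++-view (y ∷ xs) (here p) = inˡ (here p)
++-view (y ∷ xs) (there m) with ++-view xs m
... | inˡ m′ = inˡ (there m′)
... | inʳ m′ = inʳ m′

++-view-++⁺ˡ : ∀ {A : Set} {x : A} (xs : List A) {ys : List A} (m : x ∈ xs) → ++-view xs {ys} (++⁺ˡ m) ≡ inˡ m
++-view-++⁺ˡ (y ∷ xs) (here p) = refl
++-view-++⁺ˡ (y ∷ xs) {ys} (there m) rewrite ++-view-++⁺ˡ xs {ys} m = refl

++-view-++⁺ʳ : ∀ {A : Set} {x : A} (xs : List A) {ys : List A} (m : x ∈ ys) → ++-view xs (++⁺ʳ xs m) ≡ inʳ m
++-view-++⁺ʳ [] m = refl
++-view-++⁺ʳ (y ∷ xs) m rewrite ++-view-++⁺ʳ xs m = refl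

∈-⊠ʳ⁺ : ∀ {x y ys} → y ∈ ys → x ⊠ y ∈ x ⊠ʳ ys
∈-⊠ʳ⁺ (here refl) = here refl
∈-⊠ʳ⁺ (there m) = there (∈-⊠ʳ⁺ m)

∈-⊠ᴸ⁺ : ∀ {x y xs ys} → x ∈ xs → y ∈ ys → x ⊠ y ∈ xs ⊠ᴸ ys
∈-⊠ᴸ⁺ {xs = x ∷ xs} {ys} (here refl) mb = ++⁺ˡ (∈-⊠ʳ⁺ mb)
∈-⊠ᴸ⁺ {xs = x ∷ xs} {ys} (there ma) mb = ++⁺ʳ (x ⊠ʳ ys) (∈-⊠ᴸ⁺ ma mb)

data ⊠ʳ-View (x : Tree) : (ys : List Tree) {z : Tree} → z ∈ x ⊠ʳ ys → Set where
  ⊠ʳ-at : ∀ {y ys} (mb : y ∈ ys) → ⊠ʳ-View x ys (∈-⊠ʳ⁺ mb)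

⊠ʳ-view : ∀ x ys {z} (m : z ∈ x ⊠ʳ ys) → ⊠ʳ-View x ys m
⊠ʳ-view x (y ∷ ys) (here refl) = ⊠ʳ-at (here refl)
⊠ʳ-view x (y ∷ ys) (there m) with ⊠ʳ-view x ys m
... | ⊠ʳ-at mb = ⊠ʳ-at (there mb)

⊠ʳ-view-∈⁺ : ∀ x {y ys} (mb : y ∈ ys) → ⊠ʳ-view x ys (∈-⊠ʳ⁺ mb) ≡ ⊠ʳ-at mb
⊠ʳ-view-∈⁺ x (here refl) = refl
⊠ʳ-view-∈⁺ x (there mb) rewrite ⊠ʳ-view-∈⁺ x mb = refl

data ⊠ᴸ-View : (xs ys : List Tree) {z : Tree} → z ∈ xs ⊠ᴸ ys → Set where
  ⊠ᴸ-at : ∀ {x y xs ys} (ma : x ∈ xs) (mb : y ∈ ys) → ⊠ᴸ-View xs ys (∈-⊠ᴸ⁺ ma mb)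

⊠ᴸ-view : ∀ xs ys {z} (m : z ∈ xs ⊠ᴸ ys) → ⊠ᴸ-View xs ys m
⊠ᴸ-view (x ∷ xs) ys m with ++-view (x ⊠ʳ ys) m
... | inˡ m′ with ⊠ʳ-view x ys m′
...   | ⊠ʳ-at mb = ⊠ᴸ-at (here refl) mb
⊠ᴸ-view (x ∷ xs) ys m | inʳ m′ with ⊠ᴸ-view xs ys m′
...   | ⊠ᴸ-at ma mb = ⊠ᴸ-at (there ma) mb

⊠ᴸ-view-∈⁺ : ∀ {x y xs ys} (ma : x ∈ xs) (mb : y ∈ ys) → ⊠ᴸ-view xs ys (∈-⊠ᴸ⁺ ma mb) ≡ ⊠ᴸ-at ma mb
⊠ᴸ-view-∈⁺ {x} {y} {x ∷ xs} {ys} (here refl) mb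
  rewrite ++-view-++⁺ˡ (x ⊠ʳ ys) {xs ⊠ᴸ ys} (∈-⊠ʳ⁺ mb) | ⊠ʳ-view-∈⁺ x mb = refl
⊠ᴸ-view-∈⁺ {x′} {y} {x ∷ xs} {ys} (there ma) mb
  rewrite ++-view-++⁺ʳ (x ⊠ʳ ys) (∈-⊠ᴸ⁺ ma mb) | ⊠ᴸ-view-∈⁺ ma mb = refl

∈-⊠≤ʳ⁺ : ∀ {s y ys} → y ∈ ys → s ⊠≤ y ∈ s ⊠≤ʳ ys
∈-⊠≤ʳ⁺ (here refl) = here refl
∈-⊠≤ʳ⁺ (there m) = there (∈-⊠≤ʳ⁺ m)

data ⊠≤ʳ-View (s : Tree) : (ys : List Tree) {z : Tree} → z ∈ s ⊠≤ʳ ys → Set where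
  ⊠≤ʳ-at : ∀ {y ys} (mb : y ∈ ys) → ⊠≤ʳ-View s ys (∈-⊠≤ʳ⁺ mb)

⊠≤ʳ-view : ∀ s ys {z} (m : z ∈ s ⊠≤ʳ ys) → ⊠≤ʳ-View s ys m
⊠≤ʳ-view s (y ∷ ys) (here refl) = ⊠≤ʳ-at (here refl)
⊠≤ʳ-view s (y ∷ ys) (there m) with ⊠≤ʳ-view s ys m
... | ⊠≤ʳ-at mb = ⊠≤ʳ-at (there mb)

⊠≤ʳ-view-∈⁺ : ∀ s {y ys} (mb : y ∈ ys) → ⊠≤ʳ-view s ys (∈-⊠≤ʳ⁺ mb) ≡ ⊠≤ʳ-at mb
⊠≤ʳ-view-∈⁺ s (here refl) = refl
⊠≤ʳ-view-∈⁺ s (there mb) rewrite ⊠≤ʳ-view-∈⁺ s mb = refl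

∈-⊠≥ˡ⁺ : ∀ {t x xs} → x ∈ xs → x ⊠≥ t ∈ xs ⊠≥ˡ t
∈-⊠≥ˡ⁺ (here refl) = here refl
∈-⊠≥ˡ⁺ (there m) = there (∈-⊠≥ˡ⁺ m)

data ⊠≥ˡ-View (t : Tree) : (xs : List Tree) {z : Tree} → z ∈ xs ⊠≥ˡ t → Set where
  ⊠≥ˡ-at : ∀ {x xs} (ma : x ∈ xs) → ⊠≥ˡ-View t xs (∈-⊠≥ˡ⁺ ma)

⊠≥ˡ-view : ∀ t xs {z} (m : z ∈ xs ⊠≥ˡ t) → ⊠≥ˡ-View t xs m
⊠≥ˡ-view t (x ∷ xs) (here refl) = ⊠≥ˡ-at (here refl)
⊠≥ˡ-view t (x ∷ xs) (there m) with ⊠≥ˡ-view t xs m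
... | ⊠≥ˡ-at ma = ⊠≥ˡ-at (there ma)

⊠≥ˡ-view-∈⁺ : ∀ t {x xs} (ma : x ∈ xs) → ⊠≥ˡ-view t xs (∈-⊠≥ˡ⁺ ma) ≡ ⊠≥ˡ-at ma
⊠≥ˡ-view-∈⁺ t (here refl) = refl
⊠≥ˡ-view-∈⁺ t (there ma) rewrite ⊠≥ˡ-view-∈⁺ t ma = refl

split⊠ : ∀ x y → Pos (x ⊠ y) → Pos x × Pos y
split⊠ ⟨ xs ⟩ ⟨ ys ⟩ root = root , root
split⊠ ⟨ xs ⟩ ⟨ ys ⟩ (sub m r) with ⊠ᴸ-view xs ys m
... | ⊠ᴸ-at {x} {y} ma mb = sub ma (proj₁ (split⊠ x y r)) , sub mb (proj₂ (split⊠ x y r))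

join⊠ : ∀ {x y} (p : Pos x) (q : Pos y) → depth p ≡ depth q → Pos (x ⊠ y)
join⊠ root root e = root
join⊠ root (sub mb q) ()
join⊠ (sub ma p) root ()
join⊠ (sub ma p) (sub mb q) e = sub (∈-⊠ᴸ⁺ ma mb) (join⊠ p q (suc-injective e))

split-join⊠ : ∀ {x y} (p : Pos x) (q : Pos y) (e : depth p ≡ depth q) → split⊠ x y (join⊠ p q e) ≡ (p , q)
split-join⊠ root root e = refl
split-join⊠ (sub {ts = xs} ma p) (sub {ts = ys} mb q) e
  rewrite ⊠ᴸ-view-∈⁺ ma mb | split-join⊠ p q (suc-injective e) = refl

join-split⊠ : ∀ x y (r : Pos (x ⊠ y)) (e : depth (proj₁ (split⊠ x y r)) ≡ depth (proj₂ (split⊠ x y r))) →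
      join⊠ (proj₁ (split⊠ x y r)) (proj₂ (split⊠ x y r)) e ≡ r
join-split⊠ ⟨ xs ⟩ ⟨ ys ⟩ root e = refl
join-split⊠ ⟨ xs ⟩ ⟨ ys ⟩ (sub m r) e with ⊠ᴸ-view xs ys m
... | ⊠ᴸ-at {x} {y} ma mb = cong (sub (∈-⊠ᴸ⁺ ma mb)) (join-split⊠ x y r (suc-injective e))

split⊠-depth : ∀ x y (r : Pos (x ⊠ y)) → depth (proj₁ (split⊠ x y r)) ≡ depth (proj₂ (split⊠ x y r))
split⊠-depth ⟨ xs ⟩ ⟨ ys ⟩ root = refl
split⊠-depth ⟨ xs ⟩ ⟨ ys ⟩ (sub m r) with ⊠ᴸ-view xs ys m
... | ⊠ᴸ-at {x} {y} ma mb = cong suc (split⊠-depth x y r)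

split⊠-root : ∀ x y → split⊠ x y (rootOf (x ⊠ y)) ≡ (rootOf x , rootOf y)
split⊠-root ⟨ xs ⟩ ⟨ ys ⟩ = refl

split⊠-edge : ∀ x y {r r′ : Pos (x ⊠ y)} → Edge r r′ →
             Edge (proj₁ (split⊠ x y r)) (proj₁ (split⊠ x y r′))
           × Edge (proj₂ (split⊠ x y r)) (proj₂ (split⊠ x y r′))
split⊠-edge ⟨ xs ⟩ ⟨ ys ⟩ (toRoot m) with ⊠ᴸ-view xs ys m
... | ⊠ᴸ-at {x} {y} ma mb rewrite split⊠-root x y = toRoot ma , toRoot mb
split⊠-edge ⟨ xs ⟩ ⟨ ys ⟩ (inside m e) with ⊠ᴸ-view xs ys m
... | ⊠ᴸ-at {x} {y} ma mb = inside ma (proj₁ (split⊠-edge x y e)) , inside mb (proj₂ (split⊠-edge x y e))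

split⊠≤ : ∀ s t → Pos (s ⊠≤ t) → Pos s × Pos t
split⊠≤ s ⟨ ys ⟩ root = rootOf s , root
split⊠≤ s ⟨ ys ⟩ (sub m r) with ++-view (s ⊠≤ʳ ys) m
split⊠≤ s ⟨ ys ⟩ (sub m r) | inˡ m′ with ⊠≤ʳ-view s ys m′
... | ⊠≤ʳ-at {y} mb = proj₁ (split⊠≤ s y r) , sub mb (proj₂ (split⊠≤ s y r))
split⊠≤ ⟨ cs ⟩ ⟨ ys ⟩ (sub m r) | inʳ m′ with ⊠ᴸ-view cs ys m′
... | ⊠ᴸ-at {x} {y} ma mb = sub ma (proj₁ (split⊠ x y r)) , sub mb (proj₂ (split⊠ x y r))

join⊠≤ : ∀ {s t} (p : Pos s) (q : Pos t) → depth p ≤ depth q → Pos (s ⊠≤ t)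
join⊠≤ root root _ = root
join⊠≤ (sub ma p) root le = ⊥-elim (n≮0 le)
join⊠≤ {s} root (sub {ts = ys} mb q) le = sub (++⁺ˡ (∈-⊠≤ʳ⁺ mb)) (join⊠≤ {s} root q z≤n)
join⊠≤ {⟨ cs ⟩} (sub ma p) (sub {ts = ys} mb q) le with suc (depth p) ≤? depth q
... | yes le′ = sub (++⁺ˡ (∈-⊠≤ʳ⁺ mb)) (join⊠≤ (sub ma p) q le′)
... | no nle = sub (++⁺ʳ (⟨ cs ⟩ ⊠≤ʳ ys) (∈-⊠ᴸ⁺ ma mb)) (join⊠ p q (≤∧≮⇒≡ (≤-pred le) nle))

split-join⊠≤ : ∀ {s t} (p : Pos s) (q : Pos t) (le : depth p ≤ depth q) →
               split⊠≤ s t (join⊠≤ p q le) ≡ (p , q)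
split-join⊠≤ root root _ = refl
split-join⊠≤ (sub ma p) root le = ⊥-elim (n≮0 le)
split-join⊠≤ {s} root (sub {ts = ys} mb q) le
  rewrite ++-view-++⁺ˡ (s ⊠≤ʳ ys) {children s ⊠ᴸ ys} (∈-⊠≤ʳ⁺ mb) | ⊠≤ʳ-view-∈⁺ s mb
        | split-join⊠≤ {s} root q z≤n = refl
split-join⊠≤ {⟨ cs ⟩} (sub ma p) (sub {ts = ys} mb q) le with suc (depth p) ≤? depth q
... | yes le′ rewrite ++-view-++⁺ˡ (⟨ cs ⟩ ⊠≤ʳ ys) {cs ⊠ᴸ ys} (∈-⊠≤ʳ⁺ mb) | ⊠≤ʳ-view-∈⁺ ⟨ cs ⟩ mb
                    | split-join⊠≤ (sub ma p) q le′ = refl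
... | no nle rewrite ++-view-++⁺ʳ (⟨ cs ⟩ ⊠≤ʳ ys) (∈-⊠ᴸ⁺ ma mb) | ⊠ᴸ-view-∈⁺ ma mb
                   | split-join⊠ p q (≤∧≮⇒≡ (≤-pred le) nle) = refl

split⊠≤-depth : ∀ s t (r : Pos (s ⊠≤ t)) → depth (proj₁ (split⊠≤ s t r)) ≤ depth (proj₂ (split⊠≤ s t r))
split⊠≤-depth ⟨ cs ⟩ ⟨ ys ⟩ root = z≤n
split⊠≤-depth s ⟨ ys ⟩ (sub m r) with ++-view (s ⊠≤ʳ ys) m
split⊠≤-depth s ⟨ ys ⟩ (sub m r) | inˡ m′ with ⊠≤ʳ-view s ys m′
... | ⊠≤ʳ-at {y} mb = m≤n⇒m≤1+n (split⊠≤-depth s y r)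
split⊠≤-depth ⟨ cs ⟩ ⟨ ys ⟩ (sub m r) | inʳ m′ with ⊠ᴸ-view cs ys m′
... | ⊠ᴸ-at {x} {y} ma mb = s≤s (≤-reflexive (split⊠-depth x y r))

join⊠≤-irrelevant : ∀ {s t} (p : Pos s) (q : Pos t) (le le′ : depth p ≤ depth q) →
                    join⊠≤ p q le ≡ join⊠≤ p q le′
join⊠≤-irrelevant p q le le′ = cong (join⊠≤ p q) (≤-irrelevant le le′)

join⊠≤-sub : ∀ {s y ys} (p : Pos s) (mb : y ∈ ys) (q : Pos y)
             (le : depth p ≤ depth (sub mb q)) (le′ : depth p ≤ depth q) →
          join⊠≤ p (sub mb q) le ≡ sub (++⁺ˡ (∈-⊠≤ʳ⁺ mb)) (join⊠≤ p q le′)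
join⊠≤-sub root mb q le le′ = cong (sub (++⁺ˡ (∈-⊠≤ʳ⁺ mb))) (join⊠≤-irrelevant root q z≤n le′)
join⊠≤-sub (sub ma p) mb q le le′ with suc (depth p) ≤? depth q
... | yes le″ = cong (sub (++⁺ˡ (∈-⊠≤ʳ⁺ mb))) (join⊠≤-irrelevant (sub ma p) q le″ le′)
... | no nle = ⊥-elim (nle le′)

join-split⊠≤ : ∀ s t (r : Pos (s ⊠≤ t)) (le : depth (proj₁ (split⊠≤ s t r)) ≤ depth (proj₂ (split⊠≤ s t r))) →
      join⊠≤ (proj₁ (split⊠≤ s t r)) (proj₂ (split⊠≤ s t r)) le ≡ r
join-split⊠≤ ⟨ cs ⟩ ⟨ ys ⟩ root le = refl
join-split⊠≤ s ⟨ ys ⟩ (sub m r) le with ++-view (s ⊠≤ʳ ys) m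
join-split⊠≤ s ⟨ ys ⟩ (sub m r) le | inˡ m′ with ⊠≤ʳ-view s ys m′
... | ⊠≤ʳ-at {y} mb =
  trans (join⊠≤-sub (proj₁ (split⊠≤ s y r)) mb (proj₂ (split⊠≤ s y r)) le (split⊠≤-depth s y r))
                         (cong (sub (++⁺ˡ (∈-⊠≤ʳ⁺ mb))) (join-split⊠≤ s y r (split⊠≤-depth s y r)))
join-split⊠≤ ⟨ cs ⟩ ⟨ ys ⟩ (sub m r) le | inʳ m′ with ⊠ᴸ-view cs ys m′
... | ⊠ᴸ-at {x} {y} ma mb with suc (depth (proj₁ (split⊠ x y r))) ≤? depth (proj₂ (split⊠ x y r))
...   | yes le′ = ⊥-elim (<-irrefl (split⊠-depth x y r) le′)
...   | no nle = cong (sub (++⁺ʳ (⟨ cs ⟩ ⊠≤ʳ ys) (∈-⊠ᴸ⁺ ma mb))) (join-split⊠ x y r _)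

split⊠≤-root : ∀ s t → split⊠≤ s t (rootOf (s ⊠≤ t)) ≡ (rootOf s , rootOf t)
split⊠≤-root s ⟨ ys ⟩ = refl

split⊠≤-edge : ∀ s t {r r′ : Pos (s ⊠≤ t)} → Edge r r′ →
               LoopEdge (proj₁ (split⊠≤ s t r)) (proj₁ (split⊠≤ s t r′))
             × Edge (proj₂ (split⊠≤ s t r)) (proj₂ (split⊠≤ s t r′))
split⊠≤-edge s ⟨ ys ⟩ (toRoot m) with ++-view (s ⊠≤ʳ ys) m
split⊠≤-edge s ⟨ ys ⟩ (toRoot m) | inˡ m′ with ⊠≤ʳ-view s ys m′
... | ⊠≤ʳ-at {y} mb rewrite split⊠≤-root s y = inj₂ (refl , refl) , toRoot mb
split⊠≤-edge ⟨ cs ⟩ ⟨ ys ⟩ (toRoot m) | inʳ m′ with ⊠ᴸ-view cs ys m′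
... | ⊠ᴸ-at {x} {y} ma mb rewrite split⊠-root x y = inj₁ (toRoot ma) , toRoot mb
split⊠≤-edge s ⟨ ys ⟩ (inside m e) with ++-view (s ⊠≤ʳ ys) m
split⊠≤-edge s ⟨ ys ⟩ (inside m e) | inˡ m′ with ⊠≤ʳ-view s ys m′
... | ⊠≤ʳ-at {y} mb = proj₁ (split⊠≤-edge s y e) , inside mb (proj₂ (split⊠≤-edge s y e))
split⊠≤-edge ⟨ cs ⟩ ⟨ ys ⟩ (inside m e) | inʳ m′ with ⊠ᴸ-view cs ys m′
... | ⊠ᴸ-at {x} {y} ma mb =
  inj₁ (inside ma (proj₁ (split⊠-edge x y e))) , inside mb (proj₂ (split⊠-edge x y e))

split⊠≥ : ∀ s t → Pos (s ⊠≥ t) → Pos s × Pos t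
split⊠≥ ⟨ xs ⟩ t root = root , rootOf t
split⊠≥ ⟨ xs ⟩ t (sub m r) with ++-view (xs ⊠≥ˡ t) m
split⊠≥ ⟨ xs ⟩ t (sub m r) | inˡ m′ with ⊠≥ˡ-view t xs m′
... | ⊠≥ˡ-at {x} ma = sub ma (proj₁ (split⊠≥ x t r)) , proj₂ (split⊠≥ x t r)
split⊠≥ ⟨ xs ⟩ ⟨ ct ⟩ (sub m r) | inʳ m′ with ⊠ᴸ-view xs ct m′
... | ⊠ᴸ-at {x} {y} ma mb = sub ma (proj₁ (split⊠ x y r)) , sub mb (proj₂ (split⊠ x y r))

join⊠≥ : ∀ {s t} (p : Pos s) (q : Pos t) → depth q ≤ depth p → Pos (s ⊠≥ t)
join⊠≥ root root _ = root
join⊠≥ root (sub mb q) le = ⊥-elim (n≮0 le)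
join⊠≥ {t = t} (sub {ts = xs} ma p) root le = sub (++⁺ˡ (∈-⊠≥ˡ⁺ ma)) (join⊠≥ {t = t} p root z≤n)
join⊠≥ {t = ⟨ ct ⟩} (sub {ts = xs} ma p) (sub mb q) le with suc (depth q) ≤? depth p
... | yes le′ = sub (++⁺ˡ (∈-⊠≥ˡ⁺ ma)) (join⊠≥ p (sub mb q) le′)
... | no nle = sub (++⁺ʳ (xs ⊠≥ˡ ⟨ ct ⟩) (∈-⊠ᴸ⁺ ma mb)) (join⊠ p q (sym (≤∧≮⇒≡ (≤-pred le) nle)))

split-join⊠≥ : ∀ {s t} (p : Pos s) (q : Pos t) (le : depth q ≤ depth p) →
               split⊠≥ s t (join⊠≥ p q le) ≡ (p , q)
split-join⊠≥ root root _ = refl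
split-join⊠≥ root (sub mb q) le = ⊥-elim (n≮0 le)
split-join⊠≥ {t = t} (sub {ts = xs} ma p) root le
  rewrite ++-view-++⁺ˡ (xs ⊠≥ˡ t) {xs ⊠ᴸ children t} (∈-⊠≥ˡ⁺ ma) | ⊠≥ˡ-view-∈⁺ t ma
        | split-join⊠≥ {t = t} p root z≤n = refl
split-join⊠≥ {t = ⟨ ct ⟩} (sub {ts = xs} ma p) (sub mb q) le with suc (depth q) ≤? depth p
... | yes le′ rewrite ++-view-++⁺ˡ (xs ⊠≥ˡ ⟨ ct ⟩) {xs ⊠ᴸ ct} (∈-⊠≥ˡ⁺ ma) | ⊠≥ˡ-view-∈⁺ ⟨ ct ⟩ ma
                    | split-join⊠≥ p (sub mb q) le′ = refl
... | no nle rewrite ++-view-++⁺ʳ (xs ⊠≥ˡ ⟨ ct ⟩) (∈-⊠ᴸ⁺ ma mb) | ⊠ᴸ-view-∈⁺ ma mb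
                   | split-join⊠ p q (sym (≤∧≮⇒≡ (≤-pred le) nle)) = refl

split⊠≥-depth : ∀ s t (r : Pos (s ⊠≥ t)) → depth (proj₂ (split⊠≥ s t r)) ≤ depth (proj₁ (split⊠≥ s t r))
split⊠≥-depth ⟨ xs ⟩ ⟨ ct ⟩ root = z≤n
split⊠≥-depth ⟨ xs ⟩ t (sub m r) with ++-view (xs ⊠≥ˡ t) m
split⊠≥-depth ⟨ xs ⟩ t (sub m r) | inˡ m′ with ⊠≥ˡ-view t xs m′
... | ⊠≥ˡ-at {x} ma = m≤n⇒m≤1+n (split⊠≥-depth x t r)
split⊠≥-depth ⟨ xs ⟩ ⟨ ct ⟩ (sub m r) | inʳ m′ with ⊠ᴸ-view xs ct m′
... | ⊠ᴸ-at {x} {y} ma mb = s≤s (≤-reflexive (sym (split⊠-depth x y r)))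

join⊠≥-irrelevant : ∀ {s t} (p : Pos s) (q : Pos t) (le le′ : depth q ≤ depth p) →
                    join⊠≥ p q le ≡ join⊠≥ p q le′
join⊠≥-irrelevant p q le le′ = cong (join⊠≥ p q) (≤-irrelevant le le′)

join⊠≥-sub : ∀ {t x xs} (ma : x ∈ xs) (p : Pos x) (q : Pos t)
             (le : depth q ≤ depth (sub ma p)) (le′ : depth q ≤ depth p) →
          join⊠≥ (sub ma p) q le ≡ sub (++⁺ˡ (∈-⊠≥ˡ⁺ ma)) (join⊠≥ p q le′)
join⊠≥-sub ma p root le le′ = cong (sub (++⁺ˡ (∈-⊠≥ˡ⁺ ma))) (join⊠≥-irrelevant p root z≤n le′)
join⊠≥-sub ma p (sub mb q) le le′ with suc (depth q) ≤? depth p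
... | yes le″ = cong (sub (++⁺ˡ (∈-⊠≥ˡ⁺ ma))) (join⊠≥-irrelevant p (sub mb q) le″ le′)
... | no nle = ⊥-elim (nle le′)

join-split⊠≥ : ∀ s t (r : Pos (s ⊠≥ t)) (le : depth (proj₂ (split⊠≥ s t r)) ≤ depth (proj₁ (split⊠≥ s t r))) →
      join⊠≥ (proj₁ (split⊠≥ s t r)) (proj₂ (split⊠≥ s t r)) le ≡ r
join-split⊠≥ ⟨ xs ⟩ ⟨ ct ⟩ root le = refl
join-split⊠≥ ⟨ xs ⟩ t (sub m r) le with ++-view (xs ⊠≥ˡ t) m
join-split⊠≥ ⟨ xs ⟩ t (sub m r) le | inˡ m′ with ⊠≥ˡ-view t xs m′
... | ⊠≥ˡ-at {x} ma =
  trans (join⊠≥-sub ma (proj₁ (split⊠≥ x t r)) (proj₂ (split⊠≥ x t r)) le (split⊠≥-depth x t r))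
                         (cong (sub (++⁺ˡ (∈-⊠≥ˡ⁺ ma))) (join-split⊠≥ x t r (split⊠≥-depth x t r)))
join-split⊠≥ ⟨ xs ⟩ ⟨ ct ⟩ (sub m r) le | inʳ m′ with ⊠ᴸ-view xs ct m′
... | ⊠ᴸ-at {x} {y} ma mb with suc (depth (proj₂ (split⊠ x y r))) ≤? depth (proj₁ (split⊠ x y r))
...   | yes le′ = ⊥-elim (<-irrefl (sym (split⊠-depth x y r)) le′)
...   | no nle = cong (sub (++⁺ʳ (xs ⊠≥ˡ ⟨ ct ⟩) (∈-⊠ᴸ⁺ ma mb))) (join-split⊠ x y r _)

split⊠≥-root : ∀ s t → split⊠≥ s t (rootOf (s ⊠≥ t)) ≡ (rootOf s , rootOf t)
split⊠≥-root ⟨ xs ⟩ t = refl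

split⊠≥-edge : ∀ s t {r r′ : Pos (s ⊠≥ t)} → Edge r r′ →
               Edge (proj₁ (split⊠≥ s t r)) (proj₁ (split⊠≥ s t r′))
             × LoopEdge (proj₂ (split⊠≥ s t r)) (proj₂ (split⊠≥ s t r′))
split⊠≥-edge ⟨ xs ⟩ t (toRoot m) with ++-view (xs ⊠≥ˡ t) m
split⊠≥-edge ⟨ xs ⟩ t (toRoot m) | inˡ m′ with ⊠≥ˡ-view t xs m′
... | ⊠≥ˡ-at {x} ma rewrite split⊠≥-root x t = toRoot ma , inj₂ (refl , refl)
split⊠≥-edge ⟨ xs ⟩ ⟨ ct ⟩ (toRoot m) | inʳ m′ with ⊠ᴸ-view xs ct m′
... | ⊠ᴸ-at {x} {y} ma mb rewrite split⊠-root x y = toRoot ma , inj₁ (toRoot mb)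
split⊠≥-edge ⟨ xs ⟩ t (inside m e) with ++-view (xs ⊠≥ˡ t) m
split⊠≥-edge ⟨ xs ⟩ t (inside m e) | inˡ m′ with ⊠≥ˡ-view t xs m′
... | ⊠≥ˡ-at {x} ma = inside ma (proj₁ (split⊠≥-edge x t e)) , proj₂ (split⊠≥-edge x t e)
split⊠≥-edge ⟨ xs ⟩ ⟨ ct ⟩ (inside m e) | inʳ m′ with ⊠ᴸ-view xs ct m′
... | ⊠ᴸ-at {x} {y} ma mb =
  inside ma (proj₁ (split⊠-edge x y e)) , inj₁ (inside mb (proj₂ (split⊠-edge x y e)))

split⊛ : ∀ s t → Pos (s ⊛ t) → Pos s × Pos t
split⊛ ⟨ cs ⟩ ⟨ ct ⟩ root = root , root
split⊛ ⟨ cs ⟩ ⟨ ct ⟩ (sub m r) with ++-view (⟨ cs ⟩ ⊠≤ʳ ct) m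
split⊛ ⟨ cs ⟩ ⟨ ct ⟩ (sub m r) | inˡ m′ with ⊠≤ʳ-view ⟨ cs ⟩ ct m′
... | ⊠≤ʳ-at {y} mb = proj₁ (split⊠≤ ⟨ cs ⟩ y r) , sub mb (proj₂ (split⊠≤ ⟨ cs ⟩ y r))
split⊛ ⟨ cs ⟩ ⟨ ct ⟩ (sub m r) | inʳ m′ with ++-view (cs ⊠≥ˡ ⟨ ct ⟩) m′
split⊛ ⟨ cs ⟩ ⟨ ct ⟩ (sub m r) | inʳ m′ | inˡ m″ with ⊠≥ˡ-view ⟨ ct ⟩ cs m″
... | ⊠≥ˡ-at {x} ma = sub ma (proj₁ (split⊠≥ x ⟨ ct ⟩ r)) , proj₂ (split⊠≥ x ⟨ ct ⟩ r)
split⊛ ⟨ cs ⟩ ⟨ ct ⟩ (sub m r) | inʳ m′ | inʳ m″ with ⊠ᴸ-view cs ct m″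
... | ⊠ᴸ-at {x} {y} ma mb = sub ma (proj₁ (split⊠ x y r)) , sub mb (proj₂ (split⊠ x y r))

join⊛ : ∀ {s t} → Pos s → Pos t → Pos (s ⊛ t)
join⊛ root root = root
join⊛ {s} root (sub {ts = ct} mb q) = sub (++⁺ˡ (∈-⊠≤ʳ⁺ mb)) (join⊠≤ {s} root q z≤n)
join⊛ {⟨ cs ⟩} {t} (sub ma p) root =
  sub (++⁺ʳ (⟨ cs ⟩ ⊠≤ʳ children t) (++⁺ˡ (∈-⊠≥ˡ⁺ ma))) (join⊠≥ {t = t} p root z≤n)
join⊛ {⟨ cs ⟩} {⟨ ct ⟩} (sub ma p) (sub mb q) with <-cmp (depth p) (depth q)
... | tri< lt _ _ = sub (++⁺ˡ (∈-⊠≤ʳ⁺ mb)) (join⊠≤ (sub ma p) q lt)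
... | tri≈ _ eq _ = sub (++⁺ʳ (⟨ cs ⟩ ⊠≤ʳ ct) (++⁺ʳ (cs ⊠≥ˡ ⟨ ct ⟩) (∈-⊠ᴸ⁺ ma mb))) (join⊠ p q eq)
... | tri> _ _ gt = sub (++⁺ʳ (⟨ cs ⟩ ⊠≤ʳ ct) (++⁺ˡ (∈-⊠≥ˡ⁺ ma))) (join⊠≥ p (sub mb q) gt)

split-join⊛ : ∀ {s t} (p : Pos s) (q : Pos t) → split⊛ s t (join⊛ p q) ≡ (p , q)
split-join⊛ root root = refl
split-join⊛ {⟨ cs ⟩} root (sub {ts = ct} mb q)
  rewrite ++-view-++⁺ˡ (⟨ cs ⟩ ⊠≤ʳ ct) {(cs ⊠≥ˡ ⟨ ct ⟩) ++ (cs ⊠ᴸ ct)} (∈-⊠≤ʳ⁺ mb) | ⊠≤ʳ-view-∈⁺ ⟨ cs ⟩ mb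
        | split-join⊠≤ {⟨ cs ⟩} root q z≤n = refl
split-join⊛ {⟨ cs ⟩} {⟨ ct ⟩} (sub ma p) root
  rewrite ++-view-++⁺ʳ (⟨ cs ⟩ ⊠≤ʳ ct) (++⁺ˡ {ys = (cs ⊠ᴸ ct)} (∈-⊠≥ˡ⁺ {⟨ ct ⟩} ma))
        | ++-view-++⁺ˡ (cs ⊠≥ˡ ⟨ ct ⟩) {cs ⊠ᴸ ct} (∈-⊠≥ˡ⁺ ma) | ⊠≥ˡ-view-∈⁺ ⟨ ct ⟩ ma
        | split-join⊠≥ {t = ⟨ ct ⟩} p root z≤n = refl
split-join⊛ {⟨ cs ⟩} {⟨ ct ⟩} (sub ma p) (sub mb q) with <-cmp (depth p) (depth q)
... | tri< lt _ _
  rewrite ++-view-++⁺ˡ (⟨ cs ⟩ ⊠≤ʳ ct) {(cs ⊠≥ˡ ⟨ ct ⟩) ++ (cs ⊠ᴸ ct)} (∈-⊠≤ʳ⁺ mb) | ⊠≤ʳ-view-∈⁺ ⟨ cs ⟩ mb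
        | split-join⊠≤ (sub ma p) q lt = refl
... | tri≈ _ eq _
  rewrite ++-view-++⁺ʳ (⟨ cs ⟩ ⊠≤ʳ ct) (++⁺ʳ (cs ⊠≥ˡ ⟨ ct ⟩) (∈-⊠ᴸ⁺ ma mb))
        | ++-view-++⁺ʳ (cs ⊠≥ˡ ⟨ ct ⟩) (∈-⊠ᴸ⁺ ma mb) | ⊠ᴸ-view-∈⁺ ma mb
        | split-join⊠ p q eq = refl
... | tri> _ _ gt
  rewrite ++-view-++⁺ʳ (⟨ cs ⟩ ⊠≤ʳ ct) (++⁺ˡ {ys = (cs ⊠ᴸ ct)} (∈-⊠≥ˡ⁺ {⟨ ct ⟩} ma))
        | ++-view-++⁺ˡ (cs ⊠≥ˡ ⟨ ct ⟩) {cs ⊠ᴸ ct} (∈-⊠≥ˡ⁺ ma) | ⊠≥ˡ-view-∈⁺ ⟨ ct ⟩ ma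
        | split-join⊠≥ p (sub mb q) gt = refl

join⊛-⊠≤ : ∀ {cs ct y} (P : Pos ⟨ cs ⟩) (mb : y ∈ ct) (Q : Pos y) (le : depth P ≤ depth Q) →
       join⊛ {⟨ cs ⟩} {⟨ ct ⟩} P (sub mb Q) ≡ sub (++⁺ˡ (∈-⊠≤ʳ⁺ mb)) (join⊠≤ P Q le)
join⊛-⊠≤ root mb Q le = cong (sub (++⁺ˡ (∈-⊠≤ʳ⁺ mb))) (join⊠≤-irrelevant root Q z≤n le)
join⊛-⊠≤ (sub ma p) mb Q le with <-cmp (depth p) (depth Q)
... | tri< lt _ _ = cong (sub (++⁺ˡ (∈-⊠≤ʳ⁺ mb))) (join⊠≤-irrelevant (sub ma p) Q lt le)
... | tri≈ _ eq _ = ⊥-elim (<-irrefl eq le)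
... | tri> _ _ gt = ⊥-elim (<⇒≱ gt (≤-trans (n≤1+n _) le))

join⊛-⊠≥ : ∀ {cs ct x} (ma : x ∈ cs) (P : Pos x) (Q : Pos ⟨ ct ⟩) (le : depth Q ≤ depth P) →
       join⊛ {⟨ cs ⟩} {⟨ ct ⟩} (sub ma P) Q ≡ sub (++⁺ʳ (⟨ cs ⟩ ⊠≤ʳ ct) (++⁺ˡ (∈-⊠≥ˡ⁺ ma))) (join⊠≥ P Q le)
join⊛-⊠≥ ma P root le = cong (sub (++⁺ʳ _ (++⁺ˡ (∈-⊠≥ˡ⁺ ma)))) (join⊠≥-irrelevant P root z≤n le)
join⊛-⊠≥ ma P (sub mb q) le with <-cmp (depth P) (depth q)
... | tri< lt _ _ = ⊥-elim (<⇒≱ lt (≤-trans (n≤1+n _) le))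
... | tri≈ _ eq _ = ⊥-elim (<-irrefl (sym eq) le)
... | tri> _ _ gt = cong (sub (++⁺ʳ _ (++⁺ˡ (∈-⊠≥ˡ⁺ ma)))) (join⊠≥-irrelevant P (sub mb q) gt le)

join-split⊛ : ∀ s t (r : Pos (s ⊛ t)) → join⊛ (proj₁ (split⊛ s t r)) (proj₂ (split⊛ s t r)) ≡ r
join-split⊛ ⟨ cs ⟩ ⟨ ct ⟩ root = refl
join-split⊛ ⟨ cs ⟩ ⟨ ct ⟩ (sub m r) with ++-view (⟨ cs ⟩ ⊠≤ʳ ct) m
join-split⊛ ⟨ cs ⟩ ⟨ ct ⟩ (sub m r) | inˡ m′ with ⊠≤ʳ-view ⟨ cs ⟩ ct m′
... | ⊠≤ʳ-at {y} mb =
  trans (join⊛-⊠≤ (proj₁ (split⊠≤ ⟨ cs ⟩ y r)) mb (proj₂ (split⊠≤ ⟨ cs ⟩ y r)) (split⊠≤-depth ⟨ cs ⟩ y r))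
                         (cong (sub (++⁺ˡ (∈-⊠≤ʳ⁺ mb))) (join-split⊠≤ ⟨ cs ⟩ y r (split⊠≤-depth ⟨ cs ⟩ y r)))
join-split⊛ ⟨ cs ⟩ ⟨ ct ⟩ (sub m r) | inʳ m′ with ++-view (cs ⊠≥ˡ ⟨ ct ⟩) m′
join-split⊛ ⟨ cs ⟩ ⟨ ct ⟩ (sub m r) | inʳ m′ | inˡ m″ with ⊠≥ˡ-view ⟨ ct ⟩ cs m″
... | ⊠≥ˡ-at {x} ma =
  trans (join⊛-⊠≥ ma (proj₁ (split⊠≥ x ⟨ ct ⟩ r)) (proj₂ (split⊠≥ x ⟨ ct ⟩ r)) (split⊠≥-depth x ⟨ ct ⟩ r))
        (cong (sub (++⁺ʳ (⟨ cs ⟩ ⊠≤ʳ ct) (++⁺ˡ (∈-⊠≥ˡ⁺ ma))))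
              (join-split⊠≥ x ⟨ ct ⟩ r (split⊠≥-depth x ⟨ ct ⟩ r)))
join-split⊛ ⟨ cs ⟩ ⟨ ct ⟩ (sub m r) | inʳ m′ | inʳ m″ with ⊠ᴸ-view cs ct m″
... | ⊠ᴸ-at {x} {y} ma mb with <-cmp (depth (proj₁ (split⊠ x y r))) (depth (proj₂ (split⊠ x y r)))
...   | tri< _ ne _ = ⊥-elim (ne (split⊠-depth x y r))
...   | tri> _ ne _ = ⊥-elim (ne (split⊠-depth x y r))
...   | tri≈ _ eq _ =
  cong (sub (++⁺ʳ (⟨ cs ⟩ ⊠≤ʳ ct) (++⁺ʳ (cs ⊠≥ˡ ⟨ ct ⟩) (∈-⊠ᴸ⁺ ma mb)))) (join-split⊠ x y r eq)

split⊛-edge : ∀ s t {r r′ : Pos (s ⊛ t)} → Edge r r′ → E (Looped s ⊗ Looped t) (split⊛ s t r) (split⊛ s t r′)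
split⊛-edge ⟨ cs ⟩ ⟨ ct ⟩ (toRoot m) with ++-view (⟨ cs ⟩ ⊠≤ʳ ct) m
split⊛-edge ⟨ cs ⟩ ⟨ ct ⟩ (toRoot m) | inˡ m′ with ⊠≤ʳ-view ⟨ cs ⟩ ct m′
... | ⊠≤ʳ-at {y} mb rewrite split⊠≤-root ⟨ cs ⟩ y = inj₂ (refl , refl) , inj₁ (toRoot mb)
split⊛-edge ⟨ cs ⟩ ⟨ ct ⟩ (toRoot m) | inʳ m′ with ++-view (cs ⊠≥ˡ ⟨ ct ⟩) m′
split⊛-edge ⟨ cs ⟩ ⟨ ct ⟩ (toRoot m) | inʳ m′ | inˡ m″ with ⊠≥ˡ-view ⟨ ct ⟩ cs m″
... | ⊠≥ˡ-at {x} ma rewrite split⊠≥-root x ⟨ ct ⟩ = inj₁ (toRoot ma) , inj₂ (refl , refl)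
split⊛-edge ⟨ cs ⟩ ⟨ ct ⟩ (toRoot m) | inʳ m′ | inʳ m″ with ⊠ᴸ-view cs ct m″
... | ⊠ᴸ-at {x} {y} ma mb rewrite split⊠-root x y = inj₁ (toRoot ma) , inj₁ (toRoot mb)
split⊛-edge ⟨ cs ⟩ ⟨ ct ⟩ (inside m e) with ++-view (⟨ cs ⟩ ⊠≤ʳ ct) m
split⊛-edge ⟨ cs ⟩ ⟨ ct ⟩ (inside m e) | inˡ m′ with ⊠≤ʳ-view ⟨ cs ⟩ ct m′
... | ⊠≤ʳ-at {y} mb = proj₁ (split⊠≤-edge ⟨ cs ⟩ y e) , inj₁ (inside mb (proj₂ (split⊠≤-edge ⟨ cs ⟩ y e)))
split⊛-edge ⟨ cs ⟩ ⟨ ct ⟩ (inside m e) | inʳ m′ with ++-view (cs ⊠≥ˡ ⟨ ct ⟩) m′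
split⊛-edge ⟨ cs ⟩ ⟨ ct ⟩ (inside m e) | inʳ m′ | inˡ m″ with ⊠≥ˡ-view ⟨ ct ⟩ cs m″
... | ⊠≥ˡ-at {x} ma = inj₁ (inside ma (proj₁ (split⊠≥-edge x ⟨ ct ⟩ e))) , proj₂ (split⊠≥-edge x ⟨ ct ⟩ e)
split⊛-edge ⟨ cs ⟩ ⟨ ct ⟩ (inside m e) | inʳ m′ | inʳ m″ with ⊠ᴸ-view cs ct m″
... | ⊠ᴸ-at {x} {y} ma mb =
  inj₁ (inside ma (proj₁ (split⊠-edge x y e))) , inj₁ (inside mb (proj₂ (split⊠-edge x y e)))

split⊛-loopEdge : ∀ s t {r r′ : Pos (s ⊛ t)} → LoopEdge r r′ → E (Looped s ⊗ Looped t) (split⊛ s t r) (split⊛ s t r′)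
split⊛-loopEdge s t (inj₁ e) = split⊛-edge s t e
split⊛-loopEdge ⟨ cs ⟩ ⟨ ct ⟩ (inj₂ (refl , refl)) = inj₂ (refl , refl) , inj₂ (refl , refl)

⊗≅⊛ : ∀ s t → (Looped s ⊗ Looped t) ≅ Looped (s ⊛ t)
⊗≅⊛ s t = functional-≅ product (looped-functional (s ⊛ t)) pairing join-parent
  where
  product : Functional (Looped s ⊗ Looped t)
  product = ⊗-functional (looped-functional s) (looped-functional t)

  pairing : (Pos s × Pos t) ↔ Pos (s ⊛ t)
  pairing = mk↔ₛ′ (uncurry join⊛) (split⊛ s t) (join-split⊛ s t) (uncurry split-join⊛)

  join-parent : ∀ ((p , q) : Pos s × Pos t) → join⊛ (parent p) (parent q) ≡ parent (join⊛ p q)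
  join-parent (p , q) = begin
    join⊛ (parent p) (parent q)             ≡⟨ cong (uncurry join⊛) split-parent ⟨
    uncurry join⊛ (split⊛ s t (parent r))   ≡⟨ join-split⊛ s t (parent r) ⟩
    parent r                                ∎
    where
    open ≡-Reasoning
    r = join⊛ p q
    split-parent : split⊛ s t (parent r) ≡ (parent p , parent q)
    split-parent = trans (edge⇒next product (split⊛ s t r) (split⊛ s t (parent r))
                                    (split⊛-loopEdge s t (loopEdge-parent r)))
                         (cong (λ (p′ , q′) → parent p′ , parent q′) (split-join⊛ p q))

-- Multisets of heights

count≥ : ℕ → List ℕ → ℕ
count≥ m []       = 0
count≥ m (x ∷ xs) with m ≤? x
... | yes _ = suc (count≥ m xs)
... | no  _ = count≥ m xs

count≡ : ℕ → List ℕ → ℕ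
count≡ m []       = 0
count≡ m (x ∷ xs) with m ≟ x
... | yes _ = suc (count≡ m xs)
... | no  _ = count≡ m xs

count≥-++ : ∀ m xs ys → count≥ m (xs ++ ys) ≡ count≥ m xs + count≥ m ys
count≥-++ m []       ys = refl
count≥-++ m (x ∷ xs) ys with m ≤? x
... | yes _ = cong suc (count≥-++ m xs ys)
... | no  _ = count≥-++ m xs ys

count≡-++ : ∀ m xs ys → count≡ m (xs ++ ys) ≡ count≡ m xs + count≡ m ys
count≡-++ m []       ys = refl
count≡-++ m (x ∷ xs) ys with m ≟ x
... | yes _ = cong suc (count≡-++ m xs ys)
... | no  _ = count≡-++ m xs ys

count≥-∷ : ∀ m x xs → count≥ m (x ∷ xs) ≡ count≥ m [ x ] + count≥ m xs
count≥-∷ m x xs = count≥-++ m [ x ] xs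

count≡-∷ : ∀ m x xs → count≡ m (x ∷ xs) ≡ count≡ m [ x ] + count≡ m xs
count≡-∷ m x xs = count≡-++ m [ x ] xs

count≥≡count≡+count≥ : ∀ m xs → count≥ m xs ≡ count≡ m xs + count≥ (suc m) xs
count≥≡count≡+count≥ m []       = refl
count≥≡count≡+count≥ m (x ∷ xs) with m ≤? x | m ≟ x | suc m ≤? x
... | yes _   | yes _    | no _    = cong suc (count≥≡count≡+count≥ m xs)
... | yes _   | yes refl | yes m<m = ⊥-elim (1+n≰n m<m)
... | yes _   | no _     | yes _   = trans (cong suc (count≥≡count≡+count≥ m xs)) (sym (+-suc _ _))
... | yes m≤x | no m≢x   | no m≮x  = ⊥-elim (m≮x (≤∧≢⇒< m≤x m≢x))
... | no _    | no _     | no _    = count≥≡count≡+count≥ m xs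
... | no m≰m  | yes refl | _       = ⊥-elim (m≰m ≤-refl)
... | no m≰x  | no _     | yes m<x = ⊥-elim (m≰x (<⇒≤ m<x))

count≥⇒count≡ : ∀ xs ys → (∀ m → count≥ m xs ≡ count≥ m ys) → ∀ m → count≡ m xs ≡ count≡ m ys
count≥⇒count≡ xs ys same m = +-cancelʳ-≡ (count≥ (suc m) xs) (count≡ m xs) (count≡ m ys) (begin
  count≡ m xs + count≥ (suc m) xs   ≡⟨ count≥≡count≡+count≥ m xs ⟨
  count≥ m xs                       ≡⟨ same m ⟩
  count≥ m ys                       ≡⟨ count≥≡count≡+count≥ m ys ⟩
  count≡ m ys + count≥ (suc m) ys   ≡⟨ cong (count≡ m ys +_) (same (suc m)) ⟨
  count≡ m ys + count≥ (suc m) xs   ∎)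
  where open ≡-Reasoning

count≡-singleton : ∀ x → count≡ x [ x ] ≡ 1
count≡-singleton x with x ≟ x
... | yes _   = refl
... | no x≢x = ⊥-elim (x≢x refl)

count≡>0⇒∈ : ∀ x ys → 0 < count≡ x ys → x ∈ ys
count≡>0⇒∈ x (y ∷ ys) pos with x ≟ y
... | yes x≡y = here x≡y
... | no  _   = there (count≡>0⇒∈ x ys pos)

count≡⇒↭ : ∀ xs ys → (∀ m → count≡ m xs ≡ count≡ m ys) → xs ↭ ys
count≡⇒↭ []       []       same = ↭-refl
count≡⇒↭ []       (y ∷ ys) same = ⊥-elim (0≢1+n (trans (same y)
  (trans (count≡-∷ y y ys) (cong (_+ count≡ y ys) (count≡-singleton y)))))
count≡⇒↭ (x ∷ xs) ys       same with ∈-∃++ (count≡>0⇒∈ x ys x-occurs)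
  where
  x-occurs : 0 < count≡ x ys
  x-occurs = subst (0 <_) (trans (cong (_+ count≡ x xs) (sym (count≡-singleton x)))
                                 (trans (sym (count≡-∷ x x xs)) (same x))) (s≤s z≤n)
... | as , bs , refl = ↭-trans (↭-prep x (count≡⇒↭ xs (as ++ bs) same′)) (↭-sym (shift x as bs))
  where
  same′ : ∀ m → count≡ m xs ≡ count≡ m (as ++ bs)
  same′ m = +-cancelˡ-≡ (count≡ m [ x ]) (count≡ m xs) (count≡ m (as ++ bs)) (begin
    count≡ m [ x ] + count≡ m xs              ≡⟨ count≡-∷ m x xs ⟨
    count≡ m (x ∷ xs)                         ≡⟨ same m ⟩
    count≡ m (as ++ x ∷ bs)                   ≡⟨ count≡-++ m as (x ∷ bs) ⟩
    count≡ m as + count≡ m (x ∷ bs)           ≡⟨ cong (count≡ m as +_) (count≡-∷ m x bs) ⟩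
    count≡ m as + (count≡ m [ x ] + count≡ m bs) ≡⟨ x∙yz≈y∙xz (count≡ m as) (count≡ m [ x ]) (count≡ m bs) ⟩
    count≡ m [ x ] + (count≡ m as + count≡ m bs) ≡⟨ cong (count≡ m [ x ] +_) (count≡-++ m as bs) ⟨
    count≡ m [ x ] + count≡ m (as ++ bs)      ∎)
    where open ≡-Reasoning

count≥⇒↭ : ∀ xs ys → (∀ m → count≥ m xs ≡ count≥ m ys) → xs ↭ ys
count≥⇒↭ xs ys same = count≡⇒↭ xs ys (count≥⇒count≡ xs ys same)

mins : List ℕ → List ℕ → List ℕ
mins = cartesianProductWith _⊓_

count≥-⊓ : ∀ m x y → count≥ m [ x ⊓ y ] ≡ count≥ m [ x ] * count≥ m [ y ]
count≥-⊓ m x y with m ≤? x | m ≤? y | m ≤? x ⊓ y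
... | yes _   | yes _   | yes _   = refl
... | yes m≤x | yes m≤y | no m≰x⊓y = ⊥-elim (m≰x⊓y (⊓-glb m≤x m≤y))
... | yes _   | no m≰y  | yes m≤x⊓y = ⊥-elim (m≰y (≤-trans m≤x⊓y (m⊓n≤n x y)))
... | yes _   | no _    | no _    = refl
... | no m≰x  | _       | yes m≤x⊓y = ⊥-elim (m≰x (≤-trans m≤x⊓y (m⊓n≤m x y)))
... | no _    | _       | no _    = refl

count≥-map-⊓ : ∀ m x ys → count≥ m (map (x ⊓_) ys) ≡ count≥ m [ x ] * count≥ m ys
count≥-map-⊓ m x []       = sym (*-zeroʳ (count≥ m [ x ]))
count≥-map-⊓ m x (y ∷ ys) = begin
  count≥ m (x ⊓ y ∷ map (x ⊓_) ys)                    ≡⟨ count≥-∷ m (x ⊓ y) _ ⟩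
  count≥ m [ x ⊓ y ] + count≥ m (map (x ⊓_) ys)       ≡⟨ cong₂ _+_ (count≥-⊓ m x y) (count≥-map-⊓ m x ys) ⟩
  count≥ m [ x ] * count≥ m [ y ] + count≥ m [ x ] * count≥ m ys ≡⟨ *-distribˡ-+ (count≥ m [ x ]) _ _ ⟨
  count≥ m [ x ] * (count≥ m [ y ] + count≥ m ys)     ≡⟨ cong (count≥ m [ x ] *_) (count≥-∷ m y ys) ⟨
  count≥ m [ x ] * count≥ m (y ∷ ys)                  ∎
  where open ≡-Reasoning

count≥-mins : ∀ m xs ys → count≥ m (mins xs ys) ≡ count≥ m xs * count≥ m ys
count≥-mins m []       ys = refl
count≥-mins m (x ∷ xs) ys = begin
  count≥ m (map (x ⊓_) ys ++ mins xs ys)              ≡⟨ count≥-++ m (map (x ⊓_) ys) _ ⟩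
  count≥ m (map (x ⊓_) ys) + count≥ m (mins xs ys)
    ≡⟨ cong₂ _+_ (count≥-map-⊓ m x ys) (count≥-mins m xs ys) ⟩
  count≥ m [ x ] * count≥ m ys + count≥ m xs * count≥ m ys ≡⟨ *-distribʳ-+ (count≥ m ys) (count≥ m [ x ]) _ ⟨
  (count≥ m [ x ] + count≥ m xs) * count≥ m ys        ≡⟨ cong (_* count≥ m ys) (count≥-∷ m x xs) ⟨
  count≥ m (x ∷ xs) * count≥ m ys                     ∎
  where open ≡-Reasoning

count≥-replicate-≤ : ∀ {m h} c → m ≤ h → count≥ m (replicate c h) ≡ c
count≥-replicate-≤ {m} {h} zero    _   = refl
count≥-replicate-≤ {m} {h} (suc c) m≤h with m ≤? h
... | yes _   = cong suc (count≥-replicate-≤ c m≤h)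
... | no m≰h = ⊥-elim (m≰h m≤h)

count≥-replicate-≰ : ∀ {m h} c → m ≰ h → count≥ m (replicate c h) ≡ 0
count≥-replicate-≰ {m} {h} zero    _   = refl
count≥-replicate-≰ {m} {h} (suc c) m≰h with m ≤? h
... | yes m≤h = ⊥-elim (m≰h m≤h)
... | no _    = count≥-replicate-≰ c m≰h

[m∸n]+[n∸o]≡m∸o : ∀ {m n o} → o ≤ n → n ≤ m → (m ∸ n) + (n ∸ o) ≡ m ∸ o
[m∸n]+[n∸o]≡m∸o {m} {n} {o} o≤n n≤m = begin
  (m ∸ n) + (n ∸ o)   ≡⟨ +-∸-assoc (m ∸ n) o≤n ⟨
  (m ∸ n) + n ∸ o     ≡⟨ cong (_∸ o) (m∸n+n≡m n≤m) ⟩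
  m ∸ o               ∎
  where open ≡-Reasoning

-- The trees T^k_W through the heights of their subtrees

NonIncreasing : (ℕ → ℕ) → Set
NonIncreasing w = ∀ {i j} → i ≤ j → w (suc j) ≤ w (suc i)

extraHeights : (ℕ → ℕ) → ℕ → List ℕ
extraHeights w zero    = []
extraHeights w (suc k) = extraHeights w k ++ replicate (w (suc k) ∸ w (suc (suc k))) k

-- tree w k = T^k_W has height k, and heights w k lists the heights of its subtrees.
heights : (ℕ → ℕ) → ℕ → List ℕ
heights w zero    = []
heights w (suc k) = replicate (w (suc k)) k ++ extraHeights w k

rootHeights : (ℕ → ℕ) → ℕ → List ℕ
rootHeights w n = replicate (w (suc n) ∸ 1) n ++ extraHeights w n

map-replicate-++ : ∀ {A B : Set} (f : A → B) c x ys →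
                   map f (replicate c x ++ ys) ≡ replicate c (f x) ++ map f ys
map-replicate-++ f c x ys = trans (map-++ f (replicate c x) ys) (cong (_++ map f ys) (map-replicate f c x))

map-tree-extraHeights : ∀ w k → map (tree w) (extraHeights w k) ≡ extra w k
map-tree-extraHeights w zero    = refl
map-tree-extraHeights w (suc k) = begin
  map (tree w) (extraHeights w k ++ replicate c k)
    ≡⟨ map-++ (tree w) (extraHeights w k) (replicate c k) ⟩
  map (tree w) (extraHeights w k) ++ map (tree w) (replicate c k)
    ≡⟨ cong₂ _++_ (map-tree-extraHeights w k) (map-replicate (tree w) c k) ⟩
  extra w k ++ replicate c (tree w k)
    ∎
  where open ≡-Reasoning
        c = w (suc k) ∸ w (suc (suc k))

map-tree-replicate-extraHeights : ∀ w c k →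
  map (tree w) (replicate c k ++ extraHeights w k) ≡ replicate c (tree w k) ++ extra w k
map-tree-replicate-extraHeights w c k =
  trans (map-replicate-++ (tree w) c k (extraHeights w k))
        (cong (replicate c (tree w k) ++_) (map-tree-extraHeights w k))

tree≡heights : ∀ w k → tree w k ≡ ⟨ map (tree w) (heights w k) ⟩
tree≡heights w zero    = refl
tree≡heights w (suc k) = cong ⟨_⟩ (sym (map-tree-replicate-extraHeights w (w (suc k)) k))

T≡rootHeights : ∀ {n} (W : Vec ℕ (suc n)) → T W ≡ ⟨ map (tree (at W)) (rootHeights (at W) n) ⟩
T≡rootHeights {n} W = cong ⟨_⟩ (sym (map-tree-replicate-extraHeights (at W) (at W (suc n) ∸ 1) n))

∈-replicate⁻ : ∀ {h x : ℕ} c → h ∈ replicate c x → h ≡ x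
∈-replicate⁻ (suc c) (here h≡x) = h≡x
∈-replicate⁻ (suc c) (there h∈) = ∈-replicate⁻ c h∈

extraHeights-< : ∀ w k {h} → h ∈ extraHeights w k → h < k
extraHeights-< w (suc k) h∈ with ∈-++⁻ (extraHeights w k) h∈
... | inj₁ h∈′ = m<n⇒m<1+n (extraHeights-< w k h∈′)
... | inj₂ h∈′ = ≤-reflexive (cong suc (∈-replicate⁻ _ h∈′))

replicate-extraHeights-≤ : ∀ w c k {h} → h ∈ replicate c k ++ extraHeights w k → h ≤ k
replicate-extraHeights-≤ w c k h∈ with ∈-++⁻ (replicate c k) h∈
... | inj₁ h∈′ = ≤-reflexive (∈-replicate⁻ c h∈′)
... | inj₂ h∈′ = <⇒≤ (extraHeights-< w k h∈′)

heights-< : ∀ w k {h} → h ∈ heights w k → h < k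
heights-< w (suc k) h∈ = s≤s (replicate-extraHeights-≤ w (w (suc k)) k h∈)

rootHeights-≤ : ∀ w n {h} → h ∈ rootHeights w n → h ≤ n
rootHeights-≤ w n = replicate-extraHeights-≤ w (w (suc n) ∸ 1) n

module _ (w : ℕ → ℕ) (w-noninc : NonIncreasing w) where

  count≥-extraHeights : ∀ m k → count≥ m (extraHeights w k) ≡ w (suc m) ∸ w (suc k)
  count≥-extraHeights m zero    = sym (m≤n⇒m∸n≡0 (w-noninc z≤n))
  count≥-extraHeights m (suc k) = begin
    count≥ m (extraHeights w k ++ replicate c k)
      ≡⟨ count≥-++ m (extraHeights w k) (replicate c k) ⟩
    count≥ m (extraHeights w k) + count≥ m (replicate c k)
      ≡⟨ cong (_+ count≥ m (replicate c k)) (count≥-extraHeights m k) ⟩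
    (w (suc m) ∸ w (suc k)) + count≥ m (replicate c k)
      ≡⟨ last-block (m ≤? k) ⟩
    w (suc m) ∸ w (suc (suc k))
      ∎
    where
    open ≡-Reasoning
    c = w (suc k) ∸ w (suc (suc k))
    last-block : Dec (m ≤ k) →
                 (w (suc m) ∸ w (suc k)) + count≥ m (replicate c k) ≡ w (suc m) ∸ w (suc (suc k))
    last-block (yes m≤k) = trans (cong ((w (suc m) ∸ w (suc k)) +_) (count≥-replicate-≤ c m≤k))
                                 ([m∸n]+[n∸o]≡m∸o (w-noninc (n≤1+n k)) (w-noninc m≤k))
    last-block (no m≰k)  = begin
      (w (suc m) ∸ w (suc k)) + count≥ m (replicate c k)
        ≡⟨ cong₂ _+_ (m≤n⇒m∸n≡0 (w-noninc (<⇒≤ k<m))) (count≥-replicate-≰ c m≰k) ⟩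
      0
        ≡⟨ m≤n⇒m∸n≡0 (w-noninc k<m) ⟨
      w (suc m) ∸ w (suc (suc k))
        ∎
      where k<m = ≰⇒> m≰k

  count≥-replicate-extraHeights : ∀ m c k →
    count≥ m (replicate c k ++ extraHeights w k) ≡ count≥ m (replicate c k) + (w (suc m) ∸ w (suc k))
  count≥-replicate-extraHeights m c k =
    trans (count≥-++ m (replicate c k) (extraHeights w k))
          (cong (count≥ m (replicate c k) +_) (count≥-extraHeights m k))

  count≥-heights-< : ∀ {m j} → m < j → count≥ m (heights w j) ≡ w (suc m)
  count≥-heights-< {m} {suc k} (s≤s m≤k) = begin
    count≥ m (replicate (w (suc k)) k ++ extraHeights w k)
      ≡⟨ count≥-replicate-extraHeights m (w (suc k)) k ⟩
    count≥ m (replicate (w (suc k)) k) + (w (suc m) ∸ w (suc k))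
      ≡⟨ cong (_+ (w (suc m) ∸ w (suc k))) (count≥-replicate-≤ (w (suc k)) m≤k) ⟩
    w (suc k) + (w (suc m) ∸ w (suc k))                           ≡⟨ m+[n∸m]≡n (w-noninc m≤k) ⟩
    w (suc m)                                                     ∎
    where open ≡-Reasoning

  count≥-heights-≥ : ∀ {m j} → j ≤ m → count≥ m (heights w j) ≡ 0
  count≥-heights-≥ {m} {zero}  _   = refl
  count≥-heights-≥ {m} {suc k} k<m = begin
    count≥ m (replicate (w (suc k)) k ++ extraHeights w k)
      ≡⟨ count≥-replicate-extraHeights m (w (suc k)) k ⟩
    count≥ m (replicate (w (suc k)) k) + (w (suc m) ∸ w (suc k))
      ≡⟨ cong (_+ (w (suc m) ∸ w (suc k))) (count≥-replicate-≰ (w (suc k)) (<⇒≱ k<m)) ⟩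
    w (suc m) ∸ w (suc k)                                         ≡⟨ m≤n⇒m∸n≡0 (w-noninc (<⇒≤ k<m)) ⟩
    0                                                             ∎
    where open ≡-Reasoning

  suc-count≥-rootHeights : ∀ {m n} → 1 ≤ w (suc n) → m ≤ n → suc (count≥ m (rootHeights w n)) ≡ w (suc m)
  suc-count≥-rootHeights {m} {n} w-pos m≤n = begin
    suc (count≥ m (replicate (w (suc n) ∸ 1) n ++ extraHeights w n))
      ≡⟨ cong suc (count≥-replicate-extraHeights m (w (suc n) ∸ 1) n) ⟩
    suc (count≥ m (replicate (w (suc n) ∸ 1) n) + (w (suc m) ∸ w (suc n)))
      ≡⟨ cong (λ c → suc (c + (w (suc m) ∸ w (suc n)))) (count≥-replicate-≤ (w (suc n) ∸ 1) m≤n) ⟩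
    suc (w (suc n) ∸ 1) + (w (suc m) ∸ w (suc n))
      ≡⟨ cong (_+ (w (suc m) ∸ w (suc n))) (1+[n∸1]≡n w-pos) ⟩
    w (suc n) + (w (suc m) ∸ w (suc n))
      ≡⟨ m+[n∸m]≡n (w-noninc m≤n) ⟩
    w (suc m)
      ∎
    where
    open ≡-Reasoning
    1+[n∸1]≡n : ∀ {n} → 1 ≤ n → suc (n ∸ 1) ≡ n
    1+[n∸1]≡n {suc _} _ = refl

  count≥-rootHeights-> : ∀ {m n} → n < m → count≥ m (rootHeights w n) ≡ 0
  count≥-rootHeights-> {m} {n} n<m = begin
    count≥ m (replicate (w (suc n) ∸ 1) n ++ extraHeights w n)
      ≡⟨ count≥-replicate-extraHeights m (w (suc n) ∸ 1) n ⟩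
    count≥ m (replicate (w (suc n) ∸ 1) n) + (w (suc m) ∸ w (suc n))
      ≡⟨ cong (_+ (w (suc m) ∸ w (suc n))) (count≥-replicate-≰ (w (suc n) ∸ 1) (<⇒≱ n<m)) ⟩
    w (suc m) ∸ w (suc n)
      ≡⟨ m≤n⇒m∸n≡0 (w-noninc (<⇒≤ n<m)) ⟩
    0
      ∎
    where open ≡-Reasoning

pointwise-++-map : ∀ {ts₁ ts₂} (f : ℕ → Tree) hs₁ hs₂ →
                   Pointwise _≃_ ts₁ (map f hs₁) → Pointwise _≃_ ts₂ (map f hs₂) →
                   Pointwise _≃_ (ts₁ ++ ts₂) (map f (hs₁ ++ hs₂))
pointwise-++-map f hs₁ hs₂ p₁ p₂ = subst (Pointwise _≃_ _) (sym (map-++ f hs₁ hs₂)) (Pointwise.++⁺ p₁ p₂)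

⊠≤ʳ-pointwise : ∀ s (f g : ℕ → Tree) hs → (∀ {h} → h ∈ hs → s ⊠≤ f h ≃ g h) →
                Pointwise _≃_ (s ⊠≤ʳ map f hs) (map g hs)
⊠≤ʳ-pointwise s f g []       iso = []
⊠≤ʳ-pointwise s f g (h ∷ hs) iso = iso (here refl) ∷ ⊠≤ʳ-pointwise s f g hs (λ h∈ → iso (there h∈))

⊠≥ˡ-pointwise : ∀ t (f g : ℕ → Tree) hs → (∀ {h} → h ∈ hs → f h ⊠≥ t ≃ g h) →
                Pointwise _≃_ (map f hs ⊠≥ˡ t) (map g hs)
⊠≥ˡ-pointwise t f g []       iso = []
⊠≥ˡ-pointwise t f g (h ∷ hs) iso = iso (here refl) ∷ ⊠≥ˡ-pointwise t f g hs (λ h∈ → iso (there h∈))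

module _ (f g h : ℕ → Tree) where

  ⊠ʳ-pointwise : ∀ j ks → (∀ {k} → k ∈ ks → f j ⊠ g k ≃ h (j ⊓ k)) →
                 Pointwise _≃_ (f j ⊠ʳ map g ks) (map h (map (j ⊓_) ks))
  ⊠ʳ-pointwise j []       iso = []
  ⊠ʳ-pointwise j (k ∷ ks) iso = iso (here refl) ∷ ⊠ʳ-pointwise j ks (λ k∈ → iso (there k∈))

  ⊠ᴸ-pointwise : ∀ js ks → (∀ {j k} → j ∈ js → k ∈ ks → f j ⊠ g k ≃ h (j ⊓ k)) →
                 Pointwise _≃_ (map f js ⊠ᴸ map g ks) (map h (mins js ks))
  ⊠ᴸ-pointwise []       ks iso = []
  ⊠ᴸ-pointwise (j ∷ js) ks iso = pointwise-++-map h (map (j ⊓_) ks) (mins js ks)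
    (⊠ʳ-pointwise j ks (iso (here refl)))
    (⊠ᴸ-pointwise js ks (λ j∈ → iso (there j∈)))

forest≃ : ∀ (f : ℕ → Tree) {ts} hs hs′ → Pointwise _≃_ ts (map f hs) →
          (∀ m → count≥ m hs ≡ count≥ m hs′) → ⟨ ts ⟩ ≃ ⟨ map f hs′ ⟩
forest≃ f hs hs′ ts≃hs same = ≃-trans (pointwise⇒≃ ts≃hs) (↭⇒≃ (map⁺ f (count≥⇒↭ hs hs′ same)))

forest≃tree : ∀ w k {ts} hs → Pointwise _≃_ ts (map (tree w) hs) →
              (∀ m → count≥ m hs ≡ count≥ m (heights w k)) → ⟨ ts ⟩ ≃ tree w k
forest≃tree w k hs ts≃hs same =
  subst (⟨ _ ⟩ ≃_) (sym (tree≡heights w k)) (forest≃ (tree w) hs (heights w k) ts≃hs same)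

count≥-++-mins : ∀ m hs as bs → count≥ m (hs ++ mins as bs) ≡ count≥ m hs + count≥ m as * count≥ m bs
count≥-++-mins m hs as bs = trans (count≥-++ m hs (mins as bs)) (cong (count≥ m hs +_) (count≥-mins m as bs))

-- Products of the trees T^k

module _ (u v w : ℕ → ℕ) (u-noninc : NonIncreasing u) (v-noninc : NonIncreasing v)
         (w≡u*v : ∀ i → w i ≡ u i * v i) where

  w-noninc : NonIncreasing w
  w-noninc i≤j = subst₂ _≤_ (sym (w≡u*v _)) (sym (w≡u*v _)) (*-mono-≤ (u-noninc i≤j) (v-noninc i≤j))

  ⊠-counts : ∀ j k m → count≥ m (mins (heights u j) (heights v k)) ≡ count≥ m (heights w (j ⊓ k))
  ⊠-counts j k m = trans (count≥-mins m (heights u j) (heights v k)) (by-height (m <? j) (m <? k))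
    where
    open ≡-Reasoning
    by-height : Dec (m < j) → Dec (m < k) →
                count≥ m (heights u j) * count≥ m (heights v k) ≡ count≥ m (heights w (j ⊓ k))
    by-height (yes m<j) (yes m<k) = begin
      count≥ m (heights u j) * count≥ m (heights v k)
        ≡⟨ cong₂ _*_ (count≥-heights-< u u-noninc m<j) (count≥-heights-< v v-noninc m<k) ⟩
      u (suc m) * v (suc m)          ≡⟨ w≡u*v (suc m) ⟨
      w (suc m)                      ≡⟨ count≥-heights-< w w-noninc (⊓-glb m<j m<k) ⟨
      count≥ m (heights w (j ⊓ k))   ∎
    by-height (no m≮j) _ = begin
      count≥ m (heights u j) * count≥ m (heights v k)
        ≡⟨ cong (_* count≥ m (heights v k)) (count≥-heights-≥ u u-noninc (≮⇒≥ m≮j)) ⟩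
      0
        ≡⟨ count≥-heights-≥ w w-noninc (≤-trans (m⊓n≤m j k) (≮⇒≥ m≮j)) ⟨
      count≥ m (heights w (j ⊓ k))
        ∎
    by-height (yes _) (no m≮k) = begin
      count≥ m (heights u j) * count≥ m (heights v k)
        ≡⟨ cong (count≥ m (heights u j) *_) (count≥-heights-≥ v v-noninc (≮⇒≥ m≮k)) ⟩
      count≥ m (heights u j) * 0
        ≡⟨ *-zeroʳ (count≥ m (heights u j)) ⟩
      0
        ≡⟨ count≥-heights-≥ w w-noninc (≤-trans (m⊓n≤n j k) (≮⇒≥ m≮k)) ⟨
      count≥ m (heights w (j ⊓ k))
        ∎

  ⊠-tree : ∀ j k → tree u j ⊠ tree v k ≃ tree w (j ⊓ k)
  ⊠-tree = <-rec _ step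
    where
    step : ∀ j → (∀ {j′} → j′ < j → ∀ k → tree u j′ ⊠ tree v k ≃ tree w (j′ ⊓ k)) →
           ∀ k → tree u j ⊠ tree v k ≃ tree w (j ⊓ k)
    step j rec k = begin
      tree u j ⊠ tree v k
        ≡⟨ cong₂ _⊠_ (tree≡heights u j) (tree≡heights v k) ⟩
      ⟨ map (tree u) (heights u j) ⟩ ⊠ ⟨ map (tree v) (heights v k) ⟩
        ≈⟨ forest≃tree w (j ⊓ k) (mins (heights u j) (heights v k)) subtrees (⊠-counts j k) ⟩
      tree w (j ⊓ k)
        ∎
      where
      open ≃-Reasoning
      subtrees : Pointwise _≃_ (map (tree u) (heights u j) ⊠ᴸ map (tree v) (heights v k))
                               (map (tree w) (mins (heights u j) (heights v k)))
      subtrees = ⊠ᴸ-pointwise (tree u) (tree v) (tree w) (heights u j) (heights v k)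
                   λ j′∈ _ → rec (heights-< u j j′∈) _

  module _ (n : ℕ) (u-pos : 1 ≤ u (suc n)) (v-pos : 1 ≤ v (suc n)) where

    Tᵤ Tᵥ : Tree
    Tᵤ = ⟨ map (tree u) (rootHeights u n) ⟩
    Tᵥ = ⟨ map (tree v) (rootHeights v n) ⟩

    w-pos : 1 ≤ w (suc n)
    w-pos = subst (1 ≤_) (sym (w≡u*v (suc n))) (*-mono-≤ u-pos v-pos)

    ⊠≤-counts : ∀ {k} → k ≤ n → ∀ m →
                count≥ m (heights v k ++ mins (rootHeights u n) (heights v k)) ≡ count≥ m (heights w k)
    ⊠≤-counts {k} k≤n m = begin
      count≥ m (heights v k ++ mins Rᵤ (heights v k))
        ≡⟨ count≥-++-mins m (heights v k) Rᵤ (heights v k) ⟩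
      suc (count≥ m Rᵤ) * count≥ m (heights v k)
        ≡⟨ by-height (m <? k) ⟩
      count≥ m (heights w k)
        ∎
      where
      open ≡-Reasoning
      Rᵤ = rootHeights u n
      by-height : Dec (m < k) → suc (count≥ m Rᵤ) * count≥ m (heights v k) ≡ count≥ m (heights w k)
      by-height (yes m<k) = begin
        suc (count≥ m Rᵤ) * count≥ m (heights v k)
          ≡⟨ cong₂ _*_ (suc-count≥-rootHeights u u-noninc u-pos (≤-trans (<⇒≤ m<k) k≤n))
                       (count≥-heights-< v v-noninc m<k) ⟩
        u (suc m) * v (suc m)    ≡⟨ w≡u*v (suc m) ⟨
        w (suc m)                ≡⟨ count≥-heights-< w w-noninc m<k ⟨
        count≥ m (heights w k)   ∎
      by-height (no m≮k) = begin
        suc (count≥ m Rᵤ) * count≥ m (heights v k)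
          ≡⟨ cong (suc (count≥ m Rᵤ) *_) (count≥-heights-≥ v v-noninc (≮⇒≥ m≮k)) ⟩
        suc (count≥ m Rᵤ) * 0    ≡⟨ *-zeroʳ (suc (count≥ m Rᵤ)) ⟩
        0                        ≡⟨ count≥-heights-≥ w w-noninc (≮⇒≥ m≮k) ⟨
        count≥ m (heights w k)   ∎

    ⊠≥-counts : ∀ {j} → j ≤ n → ∀ m →
                count≥ m (heights u j ++ mins (heights u j) (rootHeights v n)) ≡ count≥ m (heights w j)
    ⊠≥-counts {j} j≤n m = begin
      count≥ m (heights u j ++ mins (heights u j) Rᵥ)
        ≡⟨ count≥-++-mins m (heights u j) (heights u j) Rᵥ ⟩
      count≥ m (heights u j) + count≥ m (heights u j) * count≥ m Rᵥ
        ≡⟨ *-suc (count≥ m (heights u j)) (count≥ m Rᵥ) ⟨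
      count≥ m (heights u j) * suc (count≥ m Rᵥ)
        ≡⟨ by-height (m <? j) ⟩
      count≥ m (heights w j)
        ∎
      where
      open ≡-Reasoning
      Rᵥ = rootHeights v n
      by-height : Dec (m < j) → count≥ m (heights u j) * suc (count≥ m Rᵥ) ≡ count≥ m (heights w j)
      by-height (yes m<j) = begin
        count≥ m (heights u j) * suc (count≥ m Rᵥ)
          ≡⟨ cong₂ _*_ (count≥-heights-< u u-noninc m<j)
                       (suc-count≥-rootHeights v v-noninc v-pos (≤-trans (<⇒≤ m<j) j≤n)) ⟩
        u (suc m) * v (suc m)    ≡⟨ w≡u*v (suc m) ⟨
        w (suc m)                ≡⟨ count≥-heights-< w w-noninc m<j ⟨
        count≥ m (heights w j)   ∎
      by-height (no m≮j) = begin
        count≥ m (heights u j) * suc (count≥ m Rᵥ)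
          ≡⟨ cong (_* suc (count≥ m Rᵥ)) (count≥-heights-≥ u u-noninc (≮⇒≥ m≮j)) ⟩
        0                        ≡⟨ count≥-heights-≥ w w-noninc (≮⇒≥ m≮j) ⟨
        count≥ m (heights w j)   ∎

    ⊛-counts : ∀ m → count≥ m (rootHeights v n ++ rootHeights u n ++ mins (rootHeights u n) (rootHeights v n))
                   ≡ count≥ m (rootHeights w n)
    -- counting the root once more makes the counts multiplicative
    ⊛-counts m = suc-injective (begin
      suc (count≥ m (Rᵥ ++ Rᵤ ++ mins Rᵤ Rᵥ))
        ≡⟨ cong suc (count≥-++ m Rᵥ (Rᵤ ++ mins Rᵤ Rᵥ)) ⟩
      suc (count≥ m Rᵥ + count≥ m (Rᵤ ++ mins Rᵤ Rᵥ))
        ≡⟨ cong (λ c → suc (count≥ m Rᵥ + c)) (count≥-++-mins m Rᵤ Rᵤ Rᵥ) ⟩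
      suc (count≥ m Rᵥ + (count≥ m Rᵤ + count≥ m Rᵤ * count≥ m Rᵥ))
        ≡⟨ cong (λ c → suc (count≥ m Rᵥ + c)) (*-suc (count≥ m Rᵤ) (count≥ m Rᵥ)) ⟨
      suc (count≥ m Rᵤ) * suc (count≥ m Rᵥ)
        ≡⟨ by-height (m ≤? n) ⟩
      suc (count≥ m (rootHeights w n))
        ∎)
      where
      open ≡-Reasoning
      Rᵤ = rootHeights u n
      Rᵥ = rootHeights v n
      by-height : Dec (m ≤ n) → suc (count≥ m Rᵤ) * suc (count≥ m Rᵥ) ≡ suc (count≥ m (rootHeights w n))
      by-height (yes m≤n) = begin
        suc (count≥ m Rᵤ) * suc (count≥ m Rᵥ)
          ≡⟨ cong₂ _*_ (suc-count≥-rootHeights u u-noninc u-pos m≤n)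
                       (suc-count≥-rootHeights v v-noninc v-pos m≤n) ⟩
        u (suc m) * v (suc m)              ≡⟨ w≡u*v (suc m) ⟨
        w (suc m)                          ≡⟨ suc-count≥-rootHeights w w-noninc w-pos m≤n ⟨
        suc (count≥ m (rootHeights w n))   ∎
      by-height (no m≰n) = begin
        suc (count≥ m Rᵤ) * suc (count≥ m Rᵥ)
          ≡⟨ cong₂ (λ a b → suc a * suc b) (count≥-rootHeights-> u u-noninc n<m)
                                           (count≥-rootHeights-> v v-noninc n<m) ⟩
        1                                  ≡⟨ cong suc (count≥-rootHeights-> w w-noninc n<m) ⟨
        suc (count≥ m (rootHeights w n))   ∎
        where n<m = ≰⇒> m≰n

    ⊠≤-tree : ∀ k → k ≤ n → Tᵤ ⊠≤ tree v k ≃ tree w k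
    ⊠≤-tree = <-rec _ step
      where
      step : ∀ k → (∀ {k′} → k′ < k → k′ ≤ n → Tᵤ ⊠≤ tree v k′ ≃ tree w k′) →
             k ≤ n → Tᵤ ⊠≤ tree v k ≃ tree w k
      step k rec k≤n = begin
        Tᵤ ⊠≤ tree v k                        ≡⟨ cong (Tᵤ ⊠≤_) (tree≡heights v k) ⟩
        Tᵤ ⊠≤ ⟨ map (tree v) (heights v k) ⟩  ≈⟨ forest≃tree w k _ subtrees (⊠≤-counts k≤n) ⟩
        tree w k                              ∎
        where
        open ≃-Reasoning
        subtrees : Pointwise _≃_ (children (Tᵤ ⊠≤ ⟨ map (tree v) (heights v k) ⟩))
                                 (map (tree w) (heights v k ++ mins (rootHeights u n) (heights v k)))
        subtrees = pointwise-++-map (tree w) (heights v k) (mins (rootHeights u n) (heights v k))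
          (⊠≤ʳ-pointwise Tᵤ (tree v) (tree w) (heights v k)
             (λ h∈ → rec (heights-< v k h∈) (≤-trans (<⇒≤ (heights-< v k h∈)) k≤n)))
          (⊠ᴸ-pointwise (tree u) (tree v) (tree w) (rootHeights u n) (heights v k) λ _ _ → ⊠-tree _ _)

    ⊠≥-tree : ∀ j → j ≤ n → tree u j ⊠≥ Tᵥ ≃ tree w j
    ⊠≥-tree = <-rec _ step
      where
      step : ∀ j → (∀ {j′} → j′ < j → j′ ≤ n → tree u j′ ⊠≥ Tᵥ ≃ tree w j′) →
             j ≤ n → tree u j ⊠≥ Tᵥ ≃ tree w j
      step j rec j≤n = begin
        tree u j ⊠≥ Tᵥ                        ≡⟨ cong (_⊠≥ Tᵥ) (tree≡heights u j) ⟩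
        ⟨ map (tree u) (heights u j) ⟩ ⊠≥ Tᵥ  ≈⟨ forest≃tree w j _ subtrees (⊠≥-counts j≤n) ⟩
        tree w j                              ∎
        where
        open ≃-Reasoning
        subtrees : Pointwise _≃_ (children (⟨ map (tree u) (heights u j) ⟩ ⊠≥ Tᵥ))
                                 (map (tree w) (heights u j ++ mins (heights u j) (rootHeights v n)))
        subtrees = pointwise-++-map (tree w) (heights u j) (mins (heights u j) (rootHeights v n))
          (⊠≥ˡ-pointwise Tᵥ (tree u) (tree w) (heights u j)
             (λ h∈ → rec (heights-< u j h∈) (≤-trans (<⇒≤ (heights-< u j h∈)) j≤n)))
          (⊠ᴸ-pointwise (tree u) (tree v) (tree w) (heights u j) (rootHeights v n) λ _ _ → ⊠-tree _ _)

    ⊛-rootHeights : Tᵤ ⊛ Tᵥ ≃ ⟨ map (tree w) (rootHeights w n) ⟩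
    ⊛-rootHeights = forest≃ (tree w) _ (rootHeights w n) subtrees ⊛-counts
      where
      subtrees : Pointwise _≃_ (children (Tᵤ ⊛ Tᵥ))
                   (map (tree w) (rootHeights v n ++ rootHeights u n ++
                                  mins (rootHeights u n) (rootHeights v n)))
      subtrees = pointwise-++-map (tree w) (rootHeights v n) _
        (⊠≤ʳ-pointwise Tᵤ (tree v) (tree w) (rootHeights v n) λ h∈ → ⊠≤-tree _ (rootHeights-≤ v n h∈))
        (pointwise-++-map (tree w) (rootHeights u n) (mins (rootHeights u n) (rootHeights v n))
          (⊠≥ˡ-pointwise Tᵥ (tree u) (tree w) (rootHeights u n) λ h∈ → ⊠≥-tree _ (rootHeights-≤ u n h∈))
          (⊠ᴸ-pointwise (tree u) (tree v) (tree w) (rootHeights u n) (rootHeights v n) λ _ _ → ⊠-tree _ _))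

at≡lookup : ∀ {d} (W : Vec ℕ d) i (i<d : i < d) → at W (suc i) ≡ lookup W (fromℕ< i<d)
at≡lookup (x ∷ xs) zero    (s≤s _)   = refl
at≡lookup (x ∷ xs) (suc i) (s≤s i<d) = at≡lookup xs i i<d

at-beyond : ∀ {d} (W : Vec ℕ d) i → d ≤ i → at W (suc i) ≡ 0
at-beyond []       i       _         = refl
at-beyond (x ∷ xs) (suc i) (s≤s d≤i) = at-beyond xs i d≤i

at-· : ∀ {d} (U V : Vec ℕ d) i → at (U · V) i ≡ at U i * at V i
at-· []       []       i             = refl
at-· (x ∷ xs) (y ∷ ys) zero          = refl
at-· (x ∷ xs) (y ∷ ys) (suc zero)    = refl
at-· (x ∷ xs) (y ∷ ys) (suc (suc i)) = at-· xs ys (suc i)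

at-nonIncreasing : ∀ {d} (W : Vec ℕ d) → NonIncPos W → NonIncreasing (at W)
at-nonIncreasing {d} W (_ , antitone) {i} {j} i≤j with j <? d
... | yes j<d = subst₂ _≤_ (sym (at≡lookup W j j<d)) (sym (at≡lookup W i i<d))
                  (antitone (fromℕ< i<d) (fromℕ< j<d)
                            (subst₂ _≤_ (sym (toℕ-fromℕ< i<d)) (sym (toℕ-fromℕ< j<d)) i≤j))
  where i<d = ≤-<-trans i≤j j<d
... | no j≮d  = subst (_≤ at W (suc i)) (sym (at-beyond W j (≮⇒≥ j≮d))) z≤n

at-last-positive : ∀ {n} (W : Vec ℕ (suc n)) → NonIncPos W → 1 ≤ at W (suc n)
at-last-positive {n} W (positive , _) =
  subst (1 ≤_) (sym (at≡lookup W n (n<1+n n))) (positive (fromℕ< (n<1+n n)))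

proposition2p10 : ∀ (n : ℕ) (U V : Vec ℕ (suc n)) → NonIncPos U → NonIncPos V →
    (Looped (T U) ⊗ Looped (T V)) ≅ Looped (T (U · V))
proposition2p10 n U V U-ok V-ok
  rewrite T≡rootHeights U | T≡rootHeights V | T≡rootHeights (U · V) =
  ≅-trans (⊗≅⊛ _ _) (≃⇒≅ (⊛-rootHeights (at U) (at V) (at (U · V))
                          (at-nonIncreasing U U-ok) (at-nonIncreasing V V-ok) (at-· U V)
                          n (at-last-positive U U-ok) (at-last-positive V V-ok)))
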